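{- Let $f = f(x_1, \ldots, x_n)$ be a positive threshold Boolean function with $k \geq 0$ relevant variables. Then the number of extremal points of $f$ is at least $k+1$. Moreover, $f$ has exactly $k+1$ extremal points if and only if $f$ is linear read-once.
   Context: $B=\{0,1\}$; for $x,y\in B^n$, $x\preceq y$ means $(x)_i=1$ implies $(y)_i=1$ for all $i$. $f$ is positive if $f(x)=1$ and $x\preceq y$ imply $f(y)=1$. $f$ is a threshold function if there are reals $w_1,\dots,w_n,t$ with $f(x)=0 \iff \sum_i w_i x_i\le t$ for all $x\in B^n$. A variable $x_k$ is relevant for $f$ if the restrictions $f_{|x_k=1}$ and $f_{|x_k=0}$ (obtained by fixing $x_k$ to $1$, resp. $0$) are not identical. For positive $f$, an extremal point is a maximal (w.r.t. $\preceq$) false point (a point with $f=0$) or a minimal true point (a point with $f=1$). A Boolean function is linear read-once if it is constant or representable by a nested formula, defined recursively: the literals $x$ and $\bar{x}$ are nested formulas; if $t$ is a nested formula containing neither $x$ nor $\bar x$, then $x\vee t$, $x\wedge t$, $\bar x\vee t$, $\bar x\wedge t$ are nested formulas.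
   Formalization: The weights and threshold $w_1,\dots,w_n,t$ of a threshold function are rational rather than real. -}

module Defs where

open import Data.Bool using (Bool; true; false; not; _∧_; _∨_; if_then_else_)
open import Data.Nat using (ℕ)
open import Data.Fin using (Fin)
open import Data.Vec using (Vec; lookup; zipWith; toList; _[_]≔_)
open import Data.Vec.Relation.Binary.Pointwise.Inductive using (Pointwise)
open import Data.List using (List; length; foldr; [])
open import Data.List.Relation.Unary.Unique.Propositional using (Unique)
open import Data.List.Membership.Propositional using (_∈_; _∉_)
open import Data.Rational using (ℚ; 0ℚ; _≤_)
import Data.Rational as Q
open import Data.Product using (Σ; Σ-syntax; ∃; ∃-syntax; _×_)
open import Data.Sum using (_⊎_)
open import Data.Unit using (⊤)
open import Function.Bundles using (_⇔_)
open import Relation.Binary.PropositionalEquality using (_≡_; _≢_)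
open import Relation.Nullary using (¬_)

Point : ℕ → Set
Point n = Vec Bool n

BoolFun : ℕ → Set
BoolFun n = Point n → Bool

_⪯_ : ∀ {n} → Point n → Point n → Set
x ⪯ y = Pointwise (λ a b → a ≡ true → b ≡ true) x y

Positive : ∀ {n} → BoolFun n → Set
Positive f = ∀ x y → f x ≡ true → x ⪯ y → f y ≡ true

weightedSum : ∀ {n} → Vec ℚ n → Point n → ℚ
weightedSum w x = foldr Q._+_ 0ℚ (toList (zipWith (λ wi xi → if xi then wi else 0ℚ) w x))

Threshold : ∀ {n} → BoolFun n → Set
Threshold {n} f = Σ[ w ∈ Vec ℚ n ] Σ[ t ∈ ℚ ]
  (∀ x → (f x ≡ false) ⇔ (weightedSum w x ≤ t))

Relevant : ∀ {n} → BoolFun n → Fin n → Set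
Relevant f k = ¬ (∀ x → f (x [ k ]≔ true) ≡ f (x [ k ]≔ false))

MaximalFalse : ∀ {n} → BoolFun n → Point n → Set
MaximalFalse f x = f x ≡ false × (∀ y → x ⪯ y → f y ≡ false → y ≡ x)

MinimalTrue : ∀ {n} → BoolFun n → Point n → Set
MinimalTrue f x = f x ≡ true × (∀ y → y ⪯ x → f y ≡ true → y ≡ x)

Extremal : ∀ {n} → BoolFun n → Point n → Set
Extremal f x = MaximalFalse f x ⊎ MinimalTrue f x

HasCount : {A : Set} → (A → Set) → ℕ → Set
HasCount {A} P m = Σ[ L ∈ List A ] Unique L × (∀ a → (a ∈ L) ⇔ P a) × length L ≡ m

-- nested formulas over variables x_0 .. x_{n-1}
-- lit i p     : x_i if p = true, ¬x_i if p = false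
-- node i p o t: (lit i p) ∨ t if o = true, (lit i p) ∧ t if o = false
data Nested (n : ℕ) : Set where
  lit  : Fin n → Bool → Nested n
  node : Fin n → Bool → Bool → Nested n → Nested n

vars : ∀ {n} → Nested n → List (Fin n)
vars (lit i p) = i Data.List.∷ []
vars (node i p o t) = i Data.List.∷ vars t

WellFormed : ∀ {n} → Nested n → Set
WellFormed (lit i p) = ⊤
WellFormed (node i p o t) = i ∉ vars t × WellFormed t

evalLit : ∀ {n} → Fin n → Bool → Point n → Bool
evalLit i true x = lookup x i
evalLit i false x = not (lookup x i)

eval : ∀ {n} → Nested n → Point n → Bool
eval (lit i p) x = evalLit i p x
eval (node i p true t) x = evalLit i p x ∨ eval t x
eval (node i p false t) x = evalLit i p x ∧ eval t x

LinearReadOnce : ∀ {n} → BoolFun n → Set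
LinearReadOnce {n} f =
  (Σ[ b ∈ Bool ] (∀ x → f x ≡ b))
  ⊎ (Σ[ φ ∈ Nested n ] WellFormed φ × (∀ x → f x ≡ eval φ x))

-- Split f along a variable x_i into its cofactors f₀ = f|x_i=0 ≤ f₁ = f|x_i=1. The extremal points
-- of f with x_i = 0 are the minimal true points of f₀ and the maximal false points of f₀ at which f₁
-- is true; dually for x_i = 1. Hence #extremal f is at least #extremal f₀ plus the number of "new"
-- minimal true points (minimal true for f₁, false for f₀), and at least #extremal f₁ plus the number
-- of new maximal false points; both kinds exist as soon as x_i is relevant. The cofactors of a
-- threshold function share the remaining weights, and a heavier variable dominates a lighter one, so
-- the relevant variables of f₀ and f₁ are nested and f has at most one more than the larger cofactor.
-- Induction gives #extremal f ≥ #relevant f + 1.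
-- For equality split at a heaviest variable: unless f₀ ≡ 0 or f₁ ≡ 1, trading two different ones of
-- a minimal true point of f₀ (or zeros of a maximal false point of f₁) for x_i yields two new points,
-- and the bound is strict. So f = x_i ∧ f₁ or f = x_i ∨ f₀ with the cofactor again attaining the
-- bound, which unfolds into a nested formula; conversely every literal of a nested formula adds one
-- relevant variable and one extremal point.

module Submission where

open import Defs

open import Level using (0ℓ)
open import Algebra.Bundles using (CommutativeMonoid)
open import Data.Bool using (Bool; true; false; not; _∧_; _∨_; if_then_else_)
import Data.Bool as Bool
open import Data.Bool.Properties using (¬-not; ∨-zeroʳ; ∨-identityʳ; ∧-zeroʳ; ∧-identityʳ)
open import Data.Empty using (⊥-elim)
open import Data.Fin using (Fin; zero; suc; punchIn)
import Data.Fin.Properties as Fin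
open import Data.Fin.Properties using (punchIn-injective; punchInᵢ≢i; punchIn-punchOut)
open import Data.List using (List; []; _∷_; _++_; length; map; filter; allFin)
open import Data.List.Properties using (length-++; filter-++; filter-accept; filter-reject)
open import Data.List.Membership.Propositional using (_∈_; _∉_; lose)
open import Data.List.Membership.Propositional.Properties
  using (∈-filter⁺; ∈-filter⁻; ++-∈⇔; ∈-allFin; ∈-map⁺; ∈-map⁻; ∈-++⁺ˡ; ∈-++⁺ʳ)
open import Data.List.Membership.Propositional.Properties.WithK using (unique∧set⇒bag)
open import Data.List.Relation.Binary.BagAndSetEquality using (∼bag⇒↭)
open import Data.List.Relation.Binary.Permutation.Propositional.Properties using (↭-length)
import Data.List.Relation.Unary.All as All
open import Data.List.Relation.Unary.Any using (here; there; satisfied; any?)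
open import Data.List.Relation.Unary.Unique.Propositional using (Unique; []; _∷_)
open import Data.List.Relation.Unary.Unique.Propositional.Properties using (filter⁺; ++⁺; allFin⁺; map⁺)
open import Data.Nat using (ℕ; zero; suc; _+_; _≤_; _<_; z≤n; s≤s)
open import Data.Nat.Properties
  using ( ≤-refl; ≤-trans; ≤-reflexive; <-irrefl; m≤m+n; m≤n+m; m≤n⇒m≤1+n; suc-injective
        ; +-comm; +-assoc; +-suc; +-identityʳ; +-monoˡ-≤; +-monoʳ-≤)
  renaming (module ≤-Reasoning to ℕ-≤-Reasoning)
open import Data.Product using (∃; _×_; _,_; proj₁; proj₂)
open import Data.Rational using (ℚ; 0ℚ) renaming (_≤_ to _≤ℚ_)
import Data.Rational as ℚ
import Data.Rational.Properties as QP
open import Data.Sum using (_⊎_; inj₁; inj₂; [_,_])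
open import Data.Sum.Function.Propositional using (_⊎-⇔_)
open import Data.Unit using (tt)
open import Data.Vec using (Vec; []; _∷_; lookup; insertAt; removeAt; replicate; _[_]≔_)
import Data.Vec.Properties as Vec
open import Data.Vec.Properties
  using ( insertAt-lookup; insertAt-punchIn; removeAt-insertAt; insertAt-removeAt
        ; lookup∘update; lookup∘update′; []≔-lookup; []≔-commutes; []≔-idempotent)
import Data.Vec.Relation.Binary.Pointwise.Inductive as PW
open import Data.Vec.Relation.Binary.Pointwise.Inductive using ([]; _∷_)
open import Function using (_∘_; id)
open import Function.Bundles using (_⇔_; mk⇔; Equivalence)
import Function.Properties.Equivalence as ⇔
open import Relation.Binary.Bundles using (DecTotalOrder)
open import Relation.Binary.PropositionalEquality
  using (_≡_; _≢_; refl; sym; trans; cong; cong₂; subst; subst₂; module ≡-Reasoning)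
open import Relation.Nullary using (¬_; Dec; yes; no; ¬?; does)
open import Relation.Nullary.Decidable using (map′; decidable-stable; _→-dec_; _×-dec_)
open import Relation.Unary using (Pred; Decidable; _∪_; _∩_; ∁)
open import Relation.Unary.Properties using (_∪?_; _∩?_; ∁?)

open import Algebra.Properties.CommutativeSemigroup (CommutativeMonoid.commutativeSemigroup QP.+-0-commutativeMonoid)
  using (x∙yz≈y∙xz)
open import Data.List.Extrema (DecTotalOrder.totalOrder QP.≤-decTotalOrder) using (argmax; f[xs]≤f[argmax])

open Equivalence using (to; from)

-- Counting over enumerated types

length-filter-map : ∀ {A B : Set} {P : Pred A 0ℓ} (P? : Decidable P) (g : B → A) xs →
                    length (filter P? (map g xs)) ≡ length (filter (P? ∘ g) xs)
length-filter-map P? g [] = refl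
length-filter-map P? g (x ∷ xs) with does (P? (g x))
... | true  = cong suc (length-filter-map P? g xs)
... | false = length-filter-map P? g xs

record Enumeration (A : Set) : Set where
  field
    elements : List A
    unique   : Unique elements
    complete : ∀ a → a ∈ elements

open Enumeration

module _ {A : Set} where

  private
    variable
      P Q : Pred A 0ℓ
      m m′ : ℕ

  hasCount-unique : HasCount P m → HasCount P m′ → m ≡ m′
  hasCount-unique (xs , xs! , ∈xs⇔ , refl) (ys , ys! , ∈ys⇔ , refl) =
    ↭-length (∼bag⇒↭ (unique∧set⇒bag xs! ys! (λ {a} → ⇔.trans (∈xs⇔ a) (⇔.sym (∈ys⇔ a)))))

  hasCount-cong : (∀ a → P a ⇔ Q a) → HasCount P m → HasCount Q m
  hasCount-cong P⇔Q (xs , xs! , ∈xs⇔ , len) = xs , xs! , (λ a → ⇔.trans (∈xs⇔ a) (P⇔Q a)) , len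

  hasCount-∪ : (∀ a → P a → ¬ Q a) → HasCount P m → HasCount Q m′ → HasCount (P ∪ Q) (m + m′)
  hasCount-∪ P∩Q=∅ (xs , xs! , ∈xs⇔ , refl) (ys , ys! , ∈ys⇔ , refl) =
    xs ++ ys ,
    ++⁺ xs! ys! (λ { (a∈xs , a∈ys) → P∩Q=∅ _ (to (∈xs⇔ _) a∈xs) (to (∈ys⇔ _) a∈ys) }) ,
    (λ a → ⇔.trans ++-∈⇔ (∈xs⇔ a ⊎-⇔ ∈ys⇔ a)) ,
    length-++ xs

  module _ (E : Enumeration A) where

    count : Decidable P → ℕ
    count P? = length (filter P? (elements E))

    count-hasCount : (P? : Decidable P) → HasCount P (count P?)
    count-hasCount P? =
      filter P? (elements E) , filter⁺ P? (unique E) ,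
      (λ a → mk⇔ (proj₂ ∘ ∈-filter⁻ P? {xs = elements E}) (∈-filter⁺ P? (complete E a))) , refl

    hasCount⇒≡count : (P? : Decidable P) → HasCount P m → m ≡ count P?
    hasCount⇒≡count P? hc = hasCount-unique hc (count-hasCount P?)

    count-cong : (P? : Decidable P) (Q? : Decidable Q) → (∀ a → P a ⇔ Q a) → count P? ≡ count Q?
    count-cong P? Q? P⇔Q = hasCount⇒≡count Q? (hasCount-cong P⇔Q (count-hasCount P?))

    count-∪ : (P? : Decidable P) (Q? : Decidable Q) → (∀ a → P a → ¬ Q a) →
              count (P? ∪? Q?) ≡ count P? + count Q?
    count-∪ P? Q? P∩Q=∅ =
      sym (hasCount⇒≡count (P? ∪? Q?) (hasCount-∪ P∩Q=∅ (count-hasCount P?) (count-hasCount Q?)))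

    count-partition : (P? : Decidable P) (Q? : Decidable Q) →
                      count P? ≡ count (P? ∩? Q?) + count (P? ∩? ∁? Q?)
    count-partition {P = P} {Q = Q} P? Q? = trans (count-cong P? (P∩Q? ∪? P∖Q?) split)
      (count-∪ P∩Q? P∖Q? (λ _ (_ , q) (_ , ¬q) → ¬q q))
      where
      P∩Q? = P? ∩? Q?
      P∖Q? = P? ∩? ∁? Q?
      split : ∀ a → P a ⇔ ((P a × Q a) ⊎ (P a × ¬ Q a))
      split a with Q? a
      ... | yes q = mk⇔ (λ p → inj₁ (p , q)) (λ { (inj₁ (p , _)) → p ; (inj₂ (p , _)) → p })
      ... | no ¬q = mk⇔ (λ p → inj₂ (p , ¬q)) (λ { (inj₁ (p , _)) → p ; (inj₂ (p , _)) → p })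

    count-mono : (P? : Decidable P) (Q? : Decidable Q) → (∀ a → P a → Q a) → count P? ≤ count Q?
    count-mono P? Q? P⊆Q = begin
      count P?                              ≡⟨ count-cong P? (Q? ∩? P?) (λ a → mk⇔ (λ p → P⊆Q a p , p) proj₂) ⟩
      count (Q? ∩? P?)                      ≤⟨ m≤m+n _ _ ⟩
      count (Q? ∩? P?) + count (Q? ∩? ∁? P?) ≡⟨ count-partition Q? P? ⟨
      count Q?                              ∎
      where open ℕ-≤-Reasoning

    count-≥1 : (P? : Decidable P) → ∀ {a} → P a → 1 ≤ count P?
    count-≥1 P? pa = nonempty (∈-filter⁺ P? (complete E _) pa)
      where
      nonempty : ∀ {a} {xs : List A} → a ∈ xs → 1 ≤ length xs
      nonempty {xs = _ ∷ _} _ = s≤s z≤n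

    count-≥2 : (P? : Decidable P) → ∀ {a b} → P a → P b → a ≢ b → 2 ≤ count P?
    count-≥2 P? pa pb a≢b = two-members (∈-filter⁺ P? (complete E _) pa) (∈-filter⁺ P? (complete E _) pb) a≢b
      where
      two-members : ∀ {a b} {xs : List A} → a ∈ xs → b ∈ xs → a ≢ b → 2 ≤ length xs
      two-members (here refl) (here refl) a≢b = ⊥-elim (a≢b refl)
      two-members (here _)    (there {xs = _ ∷ _} _) _ = s≤s (s≤s z≤n)
      two-members (there {xs = _ ∷ _} _) (here _) _ = s≤s (s≤s z≤n)
      two-members (there a∈) (there b∈) a≢b = m≤n⇒m≤1+n (two-members a∈ b∈ a≢b)

    count-≡0 : (P? : Decidable P) → (∀ a → ¬ P a) → count P? ≡ 0
    count-≡0 P? ∅ = sym (hasCount⇒≡count P? ([] , [] , (λ a → mk⇔ (λ ()) (⊥-elim ∘ ∅ a)) , refl))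

    count-≡1 : (P? : Decidable P) → ∀ {b} → (∀ a → P a ⇔ a ≡ b) → count P? ≡ 1
    count-≡1 P? {b} P≐b = sym (hasCount⇒≡count P?
      (b ∷ [] , All.[] ∷ [] , (λ a → ⇔.trans ∈-singleton (⇔.sym (P≐b a))) , refl))
      where
      ∈-singleton : ∀ {a} → (a ∈ b ∷ []) ⇔ (a ≡ b)
      ∈-singleton = mk⇔ (λ { (here a≡b) → a≡b ; (there ()) }) here

    ∃? : Decidable P → Dec (∃ P)
    ∃? P? = map′ satisfied (λ (a , pa) → lose (complete E a) pa) (any? P? (elements E))

    ∀? : Decidable P → Dec (∀ a → P a)
    ∀? P? = map′ (λ all a → All.lookup all (complete E a)) (λ ∀P → All.tabulate (λ {a} _ → ∀P a))
                 (All.all? P? (elements E))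

    ¬∀⇒∃¬ : Decidable P → ¬ (∀ a → P a) → ∃ (∁ P)
    ¬∀⇒∃¬ P? ¬∀P with ∃? (∁? P?)
    ... | yes ∃¬P = ∃¬P
    ... | no ¬∃¬P = ⊥-elim (¬∀P (λ a → decidable-stable (P? a) (λ ¬Pa → ¬∃¬P (a , ¬Pa))))

  count-enumeration-irrelevant : (E E′ : Enumeration A) (P? : Decidable P) → count E P? ≡ count E′ P?
  count-enumeration-irrelevant E E′ P? = hasCount⇒≡count E′ P? (count-hasCount E P?)

-- Points of the cube

private
  variable
    n : ℕ

true≢false : true ≢ false
true≢false ()

⪯-refl : {x : Point n} → x ⪯ x
⪯-refl = PW.refl id

⪯-trans : {x y z : Point n} → x ⪯ y → y ⪯ z → x ⪯ z
⪯-trans = PW.trans (λ p q → q ∘ p)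

_⪯?_ : (x y : Point n) → Dec (x ⪯ y)
_⪯?_ = PW.decidable (λ a b → (a Bool.≟ true) →-dec (b Bool.≟ true))

_≟ₚ_ : (x y : Point n) → Dec (x ≡ y)
_≟ₚ_ = Vec.≡-dec Bool._≟_

zeros ones : Point n
zeros = replicate _ false
ones  = replicate _ true

zeros-⪯ : (x : Point n) → zeros ⪯ x
zeros-⪯ []      = []
zeros-⪯ (_ ∷ x) = (λ ()) ∷ zeros-⪯ x

⪯-ones : (x : Point n) → x ⪯ ones
⪯-ones []      = []
⪯-ones (_ ∷ x) = (λ _ → refl) ∷ ⪯-ones x

⪯-zeros : {x : Point n} → x ⪯ zeros → x ≡ zeros
⪯-zeros {x = []}          []          = refl
⪯-zeros {x = false ∷ _}   (_ ∷ x⪯0)  = cong (false ∷_) (⪯-zeros x⪯0)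
⪯-zeros {x = true  ∷ _}   (1≤0 ∷ _) with () ← 1≤0 refl

ones-⪯ : {x : Point n} → ones ⪯ x → x ≡ ones
ones-⪯ {x = []}         []          = refl
ones-⪯ {x = true  ∷ _}  (_ ∷ 1⪯x)  = cong (true ∷_) (ones-⪯ 1⪯x)
ones-⪯ {x = false ∷ _}  (1≤0 ∷ _) with () ← 1≤0 refl

coordinate-or-constant : (b : Bool) (x : Point n) → (∃ λ j → lookup x j ≡ b) ⊎ x ≡ replicate n (not b)
coordinate-or-constant b [] = inj₂ refl
coordinate-or-constant b (c ∷ x) with c Bool.≟ b | coordinate-or-constant b x
... | yes refl | _              = inj₁ (zero , refl)
... | no _     | inj₁ (j , x-j) = inj₁ (suc j , x-j)
... | no c≢b   | inj₂ refl      = inj₂ (cong (_∷ _) (¬-not c≢b))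

true-point-has-one : ∀ {g : BoolFun n} {x} → g zeros ≡ false → g x ≡ true → ∃ λ j → lookup x j ≡ true
true-point-has-one {x = x} g0 gx with coordinate-or-constant true x
... | inj₁ one  = one
... | inj₂ refl = ⊥-elim (true≢false (trans (sym gx) g0))

false-point-has-zero : ∀ {g : BoolFun n} {x} → g ones ≡ true → g x ≡ false → ∃ λ j → lookup x j ≡ false
false-point-has-zero {x = x} g1 gx with coordinate-or-constant false x
... | inj₁ zero′ = zero′
... | inj₂ refl  = ⊥-elim (true≢false (trans (sym g1) gx))

[]≔false-⪯ : (x : Point n) (j : Fin n) → (x [ j ]≔ false) ⪯ x
[]≔false-⪯ (_ ∷ x) zero    = (λ ()) ∷ ⪯-refl
[]≔false-⪯ (_ ∷ x) (suc j) = id ∷ []≔false-⪯ x j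

⪯-[]≔true : (x : Point n) (j : Fin n) → x ⪯ (x [ j ]≔ true)
⪯-[]≔true (_ ∷ x) zero    = (λ _ → refl) ∷ ⪯-refl
⪯-[]≔true (_ ∷ x) (suc j) = id ∷ ⪯-[]≔true x j

[]≔-mono : ∀ (j : Fin n) {b c} {x y : Point n} → (b ≡ true → c ≡ true) → x ⪯ y → (x [ j ]≔ b) ⪯ (y [ j ]≔ c)
[]≔-mono zero    b≤c (_ ∷ x⪯y)     = b≤c ∷ x⪯y
[]≔-mono (suc j) b≤c (x₀≤y₀ ∷ x⪯y) = x₀≤y₀ ∷ []≔-mono j b≤c x⪯y

⪯-lookup-false : ∀ {x y : Point n} → x ⪯ y → ∀ l → lookup y l ≡ false → lookup x l ≡ false
⪯-lookup-false {x = x} x⪯y l y-l with lookup x l in x-l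
... | false = refl
... | true  = trans (sym (PW.lookup x⪯y l x-l)) y-l

[]≔-no-op : (x : Point n) {j : Fin n} {b : Bool} → lookup x j ≡ b → x [ j ]≔ b ≡ x
[]≔-no-op x {j} x-j = trans (cong (x [ j ]≔_) (sym x-j)) ([]≔-lookup x j)

insertAt-injective : ∀ {x y : Point n} {i b c} → insertAt x i b ≡ insertAt y i c → b ≡ c × x ≡ y
insertAt-injective {x = x} {y} {i} {b} {c} eq =
  trans (sym (insertAt-lookup x i b)) (trans (cong (λ z → lookup z i) eq) (insertAt-lookup y i c)) ,
  trans (sym (removeAt-insertAt x i b)) (trans (cong (λ z → removeAt z i) eq) (removeAt-insertAt y i c))

insertAt-mono : ∀ (i : Fin (suc n)) {b c} {x y : Point n} →
                (b ≡ true → c ≡ true) → x ⪯ y → insertAt x i b ⪯ insertAt y i c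
insertAt-mono zero    b≤c x⪯y             = b≤c ∷ x⪯y
insertAt-mono (suc i) b≤c (x₀≤y₀ ∷ x⪯y) = x₀≤y₀ ∷ insertAt-mono i b≤c x⪯y

insertAt-mono⁻ : ∀ (i : Fin (suc n)) {b c} (x y : Point n) →
                 insertAt x i b ⪯ insertAt y i c → (b ≡ true → c ≡ true) × x ⪯ y
insertAt-mono⁻ zero    x        y        (b≤c ∷ x⪯y) = b≤c , x⪯y
insertAt-mono⁻ (suc i) (_ ∷ x) (_ ∷ y) (x₀≤y₀ ∷ ins⪯ins) =
  let b≤c , x⪯y = insertAt-mono⁻ i x y ins⪯ins in b≤c , x₀≤y₀ ∷ x⪯y

∀-insertAt : ∀ (i : Fin (suc n)) {R : Point (suc n) → Set} → (∀ b y → R (insertAt y i b)) → ∀ z → R z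
∀-insertAt i {R} R-insert z = subst R (insertAt-removeAt z i) (R-insert (lookup z i) (removeAt z i))

insertAt-[]≔-same : ∀ {A : Set} (y : Vec A n) (i : Fin (suc n)) {b c : A} →
                    insertAt y i c [ i ]≔ b ≡ insertAt y i b
insertAt-[]≔-same y       zero    = refl
insertAt-[]≔-same (y₀ ∷ y) (suc i) = cong (y₀ ∷_) (insertAt-[]≔-same y i)

insertAt-[]≔-punchIn : ∀ {A : Set} (y : Vec A n) (i : Fin (suc n)) (j : Fin n) {b c : A} →
                       insertAt y i c [ punchIn i j ]≔ b ≡ insertAt (y [ j ]≔ b) i c
insertAt-[]≔-punchIn y        zero    j       = refl
insertAt-[]≔-punchIn (y₀ ∷ y) (suc i) zero    = refl
insertAt-[]≔-punchIn (y₀ ∷ y) (suc i) (suc j) = cong (y₀ ∷_) (insertAt-[]≔-punchIn y i j)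

insertAt-removeAt-[]≔ : ∀ {A : Set} (x : Vec A (suc n)) (i : Fin (suc n)) b → insertAt (removeAt x i) i b ≡ x [ i ]≔ b
insertAt-removeAt-[]≔ x i b = trans (sym (insertAt-[]≔-same (removeAt x i) i)) (cong (_[ i ]≔ b) (insertAt-removeAt x i))

lookup-punchIn-removeAt : (x : Point (suc n)) (i : Fin (suc n)) (j : Fin n) →
                          lookup x (punchIn i j) ≡ lookup (removeAt x i) j
lookup-punchIn-removeAt x i j =
  trans (cong (λ z → lookup z (punchIn i j)) (sym (insertAt-removeAt x i))) (insertAt-punchIn (removeAt x i) i (lookup x i) j)

enumerate-insertAt : Fin (suc n) → Enumeration (Point n) → Enumeration (Point (suc n))
enumerate-insertAt {n} i E = record
  { elements = map (insert false) (elements E) ++ map (insert true) (elements E)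
  ; unique   = ++⁺ (map⁺ (proj₂ ∘ insertAt-injective) (unique E)) (map⁺ (proj₂ ∘ insertAt-injective) (unique E))
                   disjoint
  ; complete = λ z → subst (_∈ _) (insertAt-removeAt z i) (member (lookup z i) (removeAt z i))
  }
  where
  insert : Bool → Point n → Point (suc n)
  insert b x = insertAt x i b
  disjoint : ∀ {z} → ¬ (z ∈ map (insert false) (elements E) × z ∈ map (insert true) (elements E))
  disjoint (z∈₀ , z∈₁) with ∈-map⁻ (insert false) z∈₀ | ∈-map⁻ (insert true) z∈₁
  ... | _ , _ , refl | _ , _ , eq with () ← proj₁ (insertAt-injective eq)
  member : ∀ b x → insert b x ∈ map (insert false) (elements E) ++ map (insert true) (elements E)
  member false x = ∈-++⁺ˡ (∈-map⁺ (insert false) (complete E x))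
  member true  x = ∈-++⁺ʳ _ (∈-map⁺ (insert true) (complete E x))

points : ∀ n → Enumeration (Point n)
points zero    = record { elements = [] ∷ [] ; unique = All.[] ∷ [] ; complete = λ { [] → here refl } }
points (suc n) = enumerate-insertAt zero (points n)

count-insertAt : ∀ {P : Pred (Point (suc n)) 0ℓ} (i : Fin (suc n)) (P? : Decidable P) →
                 count (points (suc n)) P? ≡
                 count (points n) (λ x → P? (insertAt x i false)) + count (points n) (λ x → P? (insertAt x i true))
count-insertAt {n} i P? = begin
  count (points (suc n)) P?
    ≡⟨ count-enumeration-irrelevant (points (suc n)) (enumerate-insertAt i (points n)) P? ⟩
  length (filter P? (map (insert false) xs ++ map (insert true) xs))
    ≡⟨ cong length (filter-++ P? (map (insert false) xs) _) ⟩
  length (filter P? (map (insert false) xs) ++ filter P? (map (insert true) xs))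
    ≡⟨ length-++ (filter P? (map (insert false) xs)) ⟩
  length (filter P? (map (insert false) xs)) + length (filter P? (map (insert true) xs))
    ≡⟨ cong₂ _+_ (length-filter-map P? (insert false) xs) (length-filter-map P? (insert true) xs) ⟩
  count (points n) (P? ∘ insert false) + count (points n) (P? ∘ insert true)
    ∎
  where
  open ≡-Reasoning
  xs = elements (points n)
  insert : Bool → Point n → Point (suc n)
  insert b x = insertAt x i b

fins : ∀ n → Enumeration (Fin n)
fins n = record { elements = allFin n ; unique = allFin⁺ n ; complete = ∈-allFin }

enumerate-pivot : Fin (suc n) → Enumeration (Fin (suc n))
enumerate-pivot {n} i = record
  { elements = i ∷ map (punchIn i) (allFin n)
  ; unique   = All.tabulate i∉ ∷ map⁺ (punchIn-injective i _ _) (allFin⁺ n)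
  ; complete = member
  }
  where
  i∉ : ∀ {k} → k ∈ map (punchIn i) (allFin n) → i ≢ k
  i∉ k∈ i≡k with j , _ , k≡ ← ∈-map⁻ (punchIn i) k∈ = punchInᵢ≢i i j (sym (trans i≡k k≡))
  member : ∀ k → k ∈ i ∷ map (punchIn i) (allFin n)
  member k with i Fin.≟ k
  ... | yes refl = here refl
  ... | no i≢k = there (subst (_∈ _) (punchIn-punchOut i≢k) (∈-map⁺ (punchIn i) (∈-allFin _)))

module _ {n} {Q : Pred (Fin (suc n)) 0ℓ} (Q? : Decidable Q) (i : Fin (suc n)) where

  private
    count-pivot : count (fins (suc n)) Q? ≡ length (filter Q? (i ∷ map (punchIn i) (allFin n)))
    count-pivot = count-enumeration-irrelevant (fins (suc n)) (enumerate-pivot i) Q?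

  count-punchIn-accept : Q i → count (fins (suc n)) Q? ≡ suc (count (fins n) (Q? ∘ punchIn i))
  count-punchIn-accept Qi = trans count-pivot
    (trans (cong length (filter-accept Q? Qi)) (cong suc (length-filter-map Q? (punchIn i) (allFin n))))

  count-punchIn-reject : ¬ Q i → count (fins (suc n)) Q? ≡ count (fins n) (Q? ∘ punchIn i)
  count-punchIn-reject ¬Qi = trans count-pivot
    (trans (cong length (filter-reject Q? ¬Qi)) (length-filter-map Q? (punchIn i) (allFin n)))

-- Minimal and maximal points

-- MinimalTrue f and MaximalFalse f unfold to Minimal and Maximal of the level sets of f.
Minimal Maximal : Pred (Point n) 0ℓ → Pred (Point n) 0ℓ
Minimal P x = P x × (∀ y → y ⪯ x → P y → y ≡ x)
Maximal P x = P x × (∀ y → x ⪯ y → P y → y ≡ x)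

UpwardClosed DownwardClosed : Pred (Point n) 0ℓ → Set
UpwardClosed   P = ∀ {x y} → x ⪯ y → P x → P y
DownwardClosed P = ∀ {x y} → x ⪯ y → P y → P x

minimal? : ∀ {P : Pred (Point n) 0ℓ} → Decidable P → Decidable (Minimal P)
minimal? P? x = P? x ×-dec ∀? (points _) (λ y → (y ⪯? x) →-dec (P? y →-dec (y ≟ₚ x)))

maximal? : ∀ {P : Pred (Point n) 0ℓ} → Decidable P → Decidable (Maximal P)
maximal? P? x = P? x ×-dec ∀? (points _) (λ y → (x ⪯? y) →-dec (P? y →-dec (y ≟ₚ x)))

minimal-restrict : ∀ {P Q : Pred (Point n) 0ℓ} {x} → (∀ y → Q y → P y) → Minimal P x → Q x → Minimal Q x
minimal-restrict Q⊆P (_ , min) Qx = Qx , λ y y⪯x Qy → min y y⪯x (Q⊆P y Qy)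

maximal-restrict : ∀ {P Q : Pred (Point n) 0ℓ} {x} → (∀ y → Q y → P y) → Maximal P x → Q x → Maximal Q x
maximal-restrict Q⊆P (_ , max) Qx = Qx , λ y x⪯y Qy → max y x⪯y (Q⊆P y Qy)

minimal-cong : ∀ {P Q : Pred (Point n) 0ℓ} → (∀ y → P y ⇔ Q y) → ∀ x → Minimal P x ⇔ Minimal Q x
minimal-cong P⇔Q x = mk⇔ (λ min → minimal-restrict (from ∘ P⇔Q) min (to (P⇔Q x) (proj₁ min)))
                         (λ min → minimal-restrict (to ∘ P⇔Q) min (from (P⇔Q x) (proj₁ min)))

maximal-cong : ∀ {P Q : Pred (Point n) 0ℓ} → (∀ y → P y ⇔ Q y) → ∀ x → Maximal P x ⇔ Maximal Q x
maximal-cong P⇔Q x = mk⇔ (λ max → maximal-restrict (from ∘ P⇔Q) max (to (P⇔Q x) (proj₁ max)))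
                         (λ max → maximal-restrict (to ∘ P⇔Q) max (from (P⇔Q x) (proj₁ max)))

minimal-universal : ∀ {P : Pred (Point n) 0ℓ} → (∀ y → P y) → ∀ x → Minimal P x ⇔ x ≡ zeros
minimal-universal all x = mk⇔ (λ (_ , min) → sym (min zeros (zeros-⪯ x) (all zeros)))
                              (λ { refl → all zeros , λ y y⪯0 _ → ⪯-zeros y⪯0 })

maximal-universal : ∀ {P : Pred (Point n) 0ℓ} → (∀ y → P y) → ∀ x → Maximal P x ⇔ x ≡ ones
maximal-universal all x = mk⇔ (λ (_ , max) → sym (max ones (⪯-ones x) (all ones)))
                              (λ { refl → all ones , λ y 1⪯y _ → ones-⪯ 1⪯y })

minimal-lower : ∀ {P : Pred (Point n) 0ℓ} {m} → Minimal P m → ∀ {j} → lookup m j ≡ true → ¬ P (m [ j ]≔ false)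
minimal-lower {m = m} (_ , min) {j} m-j P-lower =
  true≢false (trans (sym m-j) (trans (cong (λ z → lookup z j) (sym (min _ ([]≔false-⪯ m j) P-lower)))
                                     (lookup∘update j m false)))

maximal-raise : ∀ {P : Pred (Point n) 0ℓ} {M} → Maximal P M → ∀ {j} → lookup M j ≡ false → ¬ P (M [ j ]≔ true)
maximal-raise {M = M} (_ , max) {j} M-j P-raise =
  true≢false (trans (sym (lookup∘update j M true)) (trans (cong (λ z → lookup z j) (max _ (⪯-[]≔true M j) P-raise)) M-j))

module _ {n} {P : Pred (Point (suc n)) 0ℓ} (i : Fin (suc n)) where

  private
    P[_] : Bool → Pred (Point n) 0ℓ
    P[ b ] y = P (insertAt y i b)

  minimal-insertAt-false : ∀ {x} → Minimal P (insertAt x i false) ⇔ Minimal P[ false ] x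
  minimal-insertAt-false {x} = mk⇔
    (λ (Px , min) → Px , λ y y⪯x Py → proj₂ (insertAt-injective (min _ (insertAt-mono i id y⪯x) Py)))
    (λ (Px , min) → Px , ∀-insertAt i (below min))
    where
    below : (∀ y → y ⪯ x → P[ false ] y → y ≡ x) →
            ∀ b y → insertAt y i b ⪯ insertAt x i false → P[ b ] y → insertAt y i b ≡ insertAt x i false
    below min b y ins⪯ins Py with insertAt-mono⁻ i y x ins⪯ins
    below min false y _ Py | _ , y⪯x = cong (λ z → insertAt z i false) (min y y⪯x Py)
    below min true  y _ Py | b≤false , _ with () ← b≤false refl

  maximal-insertAt-true : ∀ {x} → Maximal P (insertAt x i true) ⇔ Maximal P[ true ] x
  maximal-insertAt-true {x} = mk⇔
    (λ (Px , max) → Px , λ y x⪯y Py → proj₂ (insertAt-injective (max _ (insertAt-mono i id x⪯y) Py)))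
    (λ (Px , max) → Px , ∀-insertAt i (above max))
    where
    above : (∀ y → x ⪯ y → P[ true ] y → y ≡ x) →
            ∀ b y → insertAt x i true ⪯ insertAt y i b → P[ b ] y → insertAt y i b ≡ insertAt x i true
    above max b y ins⪯ins Py with insertAt-mono⁻ i x y ins⪯ins
    above max true  y _ Py | _ , x⪯y = cong (λ z → insertAt z i true) (max y x⪯y Py)
    above max false y _ Py | true≤b , _ with () ← true≤b refl

  minimal-insertAt-true : UpwardClosed P → ∀ {x} →
                          Minimal P (insertAt x i true) ⇔ (Minimal P[ true ] x × ¬ P[ false ] x)
  minimal-insertAt-true up {x} = mk⇔
    (λ (Px , min) → (Px , λ y y⪯x Py → proj₂ (insertAt-injective (min _ (insertAt-mono i id y⪯x) Py))) ,
                    λ P₀x → true≢false (sym (proj₁ (insertAt-injective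
                                  (min _ (insertAt-mono i (λ _ → refl) ⪯-refl) P₀x)))))
    (λ ((Px , min) , ¬P₀x) → Px , ∀-insertAt i (below min ¬P₀x))
    where
    below : (∀ y → y ⪯ x → P[ true ] y → y ≡ x) → ¬ P[ false ] x →
            ∀ b y → insertAt y i b ⪯ insertAt x i true → P[ b ] y → insertAt y i b ≡ insertAt x i true
    below min ¬P₀x b y ins⪯ins Py with insertAt-mono⁻ i y x ins⪯ins
    below min ¬P₀x true  y _ Py | _ , y⪯x = cong (λ z → insertAt z i true) (min y y⪯x Py)
    below min ¬P₀x false y _ Py | _ , y⪯x = ⊥-elim (¬P₀x (up (insertAt-mono i id y⪯x) Py))

  maximal-insertAt-false : DownwardClosed P → ∀ {x} →
                           Maximal P (insertAt x i false) ⇔ (Maximal P[ false ] x × ¬ P[ true ] x)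
  maximal-insertAt-false down {x} = mk⇔
    (λ (Px , max) → (Px , λ y x⪯y Py → proj₂ (insertAt-injective (max _ (insertAt-mono i id x⪯y) Py))) ,
                    λ P₁x → true≢false (proj₁ (insertAt-injective (max _ (insertAt-mono i (λ _ → refl) ⪯-refl) P₁x))))
    (λ ((Px , max) , ¬P₁x) → Px , ∀-insertAt i (above max ¬P₁x))
    where
    above : (∀ y → x ⪯ y → P[ false ] y → y ≡ x) → ¬ P[ true ] x →
            ∀ b y → insertAt x i false ⪯ insertAt y i b → P[ b ] y → insertAt y i b ≡ insertAt x i false
    above max ¬P₁x b y ins⪯ins Py with insertAt-mono⁻ i x y ins⪯ins
    above max ¬P₁x false y _ Py | _ , x⪯y = cong (λ z → insertAt z i false) (max y x⪯y Py)
    above max ¬P₁x true  y _ Py | _ , x⪯y = ⊥-elim (¬P₁x (down (insertAt-mono i id x⪯y) Py))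

minimal-below : ∀ {P : Pred (Point n) 0ℓ} → Decidable P → ∀ {p} → P p → ∃ λ m → m ⪯ p × Minimal P m
minimal-below {zero} P? {[]} Pp = [] , [] , Pp , λ { [] [] _ → refl }
minimal-below {suc n} {P} P? {false ∷ p} Pp =
  let m , m⪯p , min = minimal-below (P? ∘ (false ∷_)) Pp
  in false ∷ m , id ∷ m⪯p , from (minimal-insertAt-false {P = P} zero) min
minimal-below {suc n} {P} P? {true ∷ p} Pp with ∃? (points n) (λ y → (y ⪯? p) ×-dec P? (false ∷ y))
... | yes (y , y⪯p , P₀y) =
  let m , m⪯y , min = minimal-below (P? ∘ (false ∷_)) P₀y
  in false ∷ m , (λ _ → refl) ∷ ⪯-trans m⪯y y⪯p , from (minimal-insertAt-false {P = P} zero) min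
... | no ¬P₀-below-p =
  let m , m⪯p , Pm , min = minimal-below (P? ∘ (true ∷_)) Pp
  in true ∷ m , id ∷ m⪯p , Pm ,
     λ { (false ∷ y) (_ ∷ y⪯m) Py → ⊥-elim (¬P₀-below-p (y , ⪯-trans y⪯m m⪯p , Py))
       ; (true  ∷ y) (_ ∷ y⪯m) Py → cong (true ∷_) (min y y⪯m Py) }

maximal-above : ∀ {P : Pred (Point n) 0ℓ} → Decidable P → ∀ {p} → P p → ∃ λ M → p ⪯ M × Maximal P M
maximal-above {zero} P? {[]} Pp = [] , [] , Pp , λ { [] [] _ → refl }
maximal-above {suc n} {P} P? {true ∷ p} Pp =
  let M , p⪯M , max = maximal-above (P? ∘ (true ∷_)) Pp
  in true ∷ M , id ∷ p⪯M , from (maximal-insertAt-true {P = P} zero) max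
maximal-above {suc n} {P} P? {false ∷ p} Pp with ∃? (points n) (λ y → (p ⪯? y) ×-dec P? (true ∷ y))
... | yes (y , p⪯y , P₁y) =
  let M , y⪯M , max = maximal-above (P? ∘ (true ∷_)) P₁y
  in true ∷ M , (λ _ → refl) ∷ ⪯-trans p⪯y y⪯M , from (maximal-insertAt-true {P = P} zero) max
... | no ¬P₁-above-p =
  let M , p⪯M , PM , max = maximal-above (P? ∘ (false ∷_)) Pp
  in false ∷ M , id ∷ p⪯M , PM ,
     λ { (true  ∷ y) (_ ∷ M⪯y) Py → ⊥-elim (¬P₁-above-p (y , ⪯-trans p⪯M M⪯y , Py))
       ; (false ∷ y) (_ ∷ M⪯y) Py → cong (false ∷_) (max y M⪯y Py) }

-- Positive functions and their cofactors

true-upward : ∀ {f : BoolFun n} → Positive f → UpwardClosed (λ x → f x ≡ true)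
true-upward pos x⪯y fx = pos _ _ fx x⪯y

false-downward : ∀ {f : BoolFun n} → Positive f → DownwardClosed (λ x → f x ≡ false)
false-downward {f = f} pos {x} {y} x⪯y fy with f x in fx
... | false = refl
... | true  = trans (sym (pos x y fx x⪯y)) fy

positive-cong : ∀ {f g : BoolFun n} → (∀ x → f x ≡ g x) → Positive f → Positive g
positive-cong f≗g pos x y gx x⪯y = trans (sym (f≗g y)) (pos x y (trans (f≗g x) gx) x⪯y)

positive-∘-[]≔ : ∀ {f : BoolFun n} → Positive f → ∀ i b → Positive (λ x → f (x [ i ]≔ b))
positive-∘-[]≔ pos i b x y fx x⪯y = pos _ _ fx ([]≔-mono i id x⪯y)

positive-no-antiswitch : ∀ {f : BoolFun n} → Positive f → ∀ {i z} →
                         ¬ (f (z [ i ]≔ false) ≡ true × f (z [ i ]≔ true) ≡ false)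
positive-no-antiswitch pos {i} (on , off) = true≢false (trans (sym (pos _ _ on ([]≔-mono i (λ _ → refl) ⪯-refl))) off)

cofactor : BoolFun (suc n) → Fin (suc n) → Bool → BoolFun n
cofactor f i b x = f (insertAt x i b)

cofactor-positive : ∀ {f : BoolFun (suc n)} → Positive f → ∀ i b → Positive (cofactor f i b)
cofactor-positive pos i b x y fx x⪯y = pos _ _ fx (insertAt-mono i id x⪯y)

-- Weights and dominance

-- The only consequence of a threshold representation that the argument uses; unlike the
-- representation itself it passes to cofactors without adjusting a threshold.
record RespectsWeights (w : Vec ℚ n) (f : BoolFun n) : Set where
  constructor respectsWeights
  field
    weight-monotone : ∀ x y → weightedSum w x ≤ℚ weightedSum w y → f x ≡ true → f y ≡ true

open RespectsWeights

threshold⇒respectsWeights : ∀ {f : BoolFun n} → Threshold f → ∃ λ w → RespectsWeights w f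
threshold⇒respectsWeights {f = f} (w , t , f≡false⇔≤t) = w , respectsWeights monotone
  where
  monotone : ∀ x y → weightedSum w x ≤ℚ weightedSum w y → f x ≡ true → f y ≡ true
  monotone x y wx≤wy fx with f y in fy
  ... | true  = refl
  ... | false = trans (sym (from (f≡false⇔≤t x) (QP.≤-trans wx≤wy (to (f≡false⇔≤t y) fy)))) fx

weightedSum-insertAt : (w : Vec ℚ (suc n)) (i : Fin (suc n)) (b : Bool) (y : Point n) →
                       weightedSum w (insertAt y i b) ≡ (if b then lookup w i else 0ℚ) ℚ.+ weightedSum (removeAt w i) y
weightedSum-insertAt (w₀ ∷ w)     zero    b y       = refl
weightedSum-insertAt (w₀ ∷ w₁ ∷ w) (suc i) b (y₀ ∷ y) =
  trans (cong ((if y₀ then w₀ else 0ℚ) ℚ.+_) (weightedSum-insertAt (w₁ ∷ w) i b y))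
        (x∙yz≈y∙xz (if y₀ then w₀ else 0ℚ) (if b then lookup (w₁ ∷ w) i else 0ℚ)
                   (weightedSum (removeAt (w₁ ∷ w) i) y))

weightedSum-[]≔true : (w : Vec ℚ n) (x : Point n) (u : Fin n) →
                      weightedSum w (x [ u ]≔ true) ≡ lookup w u ℚ.+ weightedSum w (x [ u ]≔ false)
weightedSum-[]≔true (w₀ ∷ w) (x₀ ∷ x) zero    = cong (w₀ ℚ.+_) (sym (QP.+-identityˡ _))
weightedSum-[]≔true (w₀ ∷ w) (x₀ ∷ x) (suc u) =
  trans (cong ((if x₀ then w₀ else 0ℚ) ℚ.+_) (weightedSum-[]≔true w x u))
        (x∙yz≈y∙xz (if x₀ then w₀ else 0ℚ) (lookup w u) (weightedSum w (x [ u ]≔ false)))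

cofactor-respectsWeights : ∀ {w} {f : BoolFun (suc n)} → RespectsWeights w f →
                           ∀ i b → RespectsWeights (removeAt w i) (cofactor f i b)
cofactor-respectsWeights {w = w} rw i b = respectsWeights λ x y wx≤wy →
  weight-monotone rw _ _ (subst₂ _≤ℚ_ (sym (weightedSum-insertAt w i b x)) (sym (weightedSum-insertAt w i b y))
                     (QP.+-monoʳ-≤ (if b then lookup w i else 0ℚ) wx≤wy))

Dominates : BoolFun n → Fin n → Fin n → Set
Dominates f u v = ∀ x → f (x [ u ]≔ false [ v ]≔ true) ≡ true → f (x [ u ]≔ true [ v ]≔ false) ≡ true

heavier-dominates : ∀ {w} {f : BoolFun n} {u v} → RespectsWeights w f → u ≢ v →
                    lookup w v ≤ℚ lookup w u → Dominates f u v
heavier-dominates {w = w} {u = u} {v} rw u≢v wv≤wu x = weight-monotone rw _ _ (begin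
  Σw (x [ u ]≔ false [ v ]≔ true)               ≡⟨ weightedSum-[]≔true w (x [ u ]≔ false) v ⟩
  lookup w v ℚ.+ Σw (x [ u ]≔ false [ v ]≔ false) ≤⟨ QP.+-monoˡ-≤ _ wv≤wu ⟩
  lookup w u ℚ.+ Σw (x [ u ]≔ false [ v ]≔ false) ≡⟨ cong ((lookup w u ℚ.+_) ∘ Σw) ([]≔-commutes x u v u≢v) ⟩
  lookup w u ℚ.+ Σw (x [ v ]≔ false [ u ]≔ false) ≡⟨ sym (weightedSum-[]≔true w (x [ v ]≔ false) u) ⟩
  Σw (x [ v ]≔ false [ u ]≔ true)               ≡⟨ cong Σw ([]≔-commutes x v u (u≢v ∘ sym)) ⟩
  Σw (x [ u ]≔ true [ v ]≔ false)               ∎)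
  where
  open QP.≤-Reasoning
  Σw = weightedSum w

-- Relevant variables

Switch : BoolFun n → Fin n → Point n → Set
Switch f k x = f (x [ k ]≔ true) ≡ true × f (x [ k ]≔ false) ≡ false

Switchable : BoolFun n → Fin n → Set
Switchable f k = ∃ (Switch f k)

switchable? : (f : BoolFun n) → Decidable (Switchable f)
switchable? f k = ∃? (points _) (λ x → (f (x [ k ]≔ true) Bool.≟ true) ×-dec (f (x [ k ]≔ false) Bool.≟ false))

relevant⇔switchable : ∀ {f : BoolFun n} → Positive f → ∀ k → Relevant f k ⇔ Switchable f k
relevant⇔switchable {f = f} pos k = mk⇔ to′ (λ (x , on , off) same → true≢false (trans (sym on) (trans (same x) off)))
  where
  to′ : Relevant f k → Switchable f k
  to′ rel with x , differ ← ¬∀⇒∃¬ (points _) (λ x → f (x [ k ]≔ true) Bool.≟ f (x [ k ]≔ false)) rel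
             with f (x [ k ]≔ true) in on | f (x [ k ]≔ false) in off
  ... | true  | false = x , on , off
  ... | false | true  = ⊥-elim (true≢false (trans (sym (pos _ _ off ([]≔-mono k (λ _ → refl) ⪯-refl))) on))
  ... | true  | true  = ⊥-elim (differ refl)
  ... | false | false = ⊥-elim (differ refl)

switchable-cong : ∀ {g h : BoolFun n} → (∀ x → g x ≡ h x) → ∀ {j} → Switchable g j → Switchable h j
switchable-cong g≗h (x , on , off) = x , trans (sym (g≗h _)) on , trans (sym (g≗h _)) off

constant-unswitchable : ∀ {g : BoolFun n} {b} → (∀ x → g x ≡ b) → ∀ {j} → ¬ Switchable g j
constant-unswitchable g≡b (x , on , off) = true≢false (trans (sym on) (trans (g≡b _) (trans (sym (g≡b _)) off)))

dominates-switchable : ∀ {f : BoolFun n} {u v} → u ≢ v → Dominates f u v → Switchable f v → Switchable f u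
dominates-switchable {f = f} {u} {v} u≢v dom (x , on , off) with lookup x u in x-u
... | false = x [ v ]≔ false ,
  subst (λ z → f z ≡ true) ([]≔-commutes x u v u≢v)
        (dom x (subst (λ z → f (z [ v ]≔ true) ≡ true) (sym ([]≔-no-op x x-u)) on)) ,
  subst (λ z → f z ≡ false) (sym ([]≔-no-op (x [ v ]≔ false) (trans (lookup∘update′ u≢v x false) x-u))) off
... | true with f (x [ v ]≔ true [ u ]≔ false) in off′
...   | false = x [ v ]≔ true ,
  subst (λ z → f z ≡ true) (sym ([]≔-no-op (x [ v ]≔ true) (trans (lookup∘update′ u≢v x true) x-u))) on , off′
...   | true  = ⊥-elim (true≢false (trans (sym on′) off))
  where
  on′ : f (x [ v ]≔ false) ≡ true
  on′ = subst (λ z → f (z [ v ]≔ false) ≡ true) ([]≔-no-op x x-u)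
          (dom x (subst (λ z → f z ≡ true) ([]≔-commutes x v u (u≢v ∘ sym)) off′))

-- Any two variables are comparable by weight, and the heavier one dominates in both g and h.
switchable-nested : ∀ {w} {g h : BoolFun n} → RespectsWeights w g → RespectsWeights w h →
                    (∀ j → Switchable h j → Switchable g j) ⊎ (∀ j → Switchable g j → Switchable h j)
switchable-nested {w = w} {g} {h} rw-g rw-h with Fin.any? (λ v → switchable? h v ×-dec ¬? (switchable? g v))
... | no ¬h∖g = inj₁ λ j h-j → decidable-stable (switchable? g j) (λ ¬g-j → ¬h∖g (j , h-j , ¬g-j))
... | yes (v , h-v , ¬g-v) = inj₂ h-contains-g
  where
  h-contains-g : ∀ u → Switchable g u → Switchable h u
  h-contains-g u g-u with u Fin.≟ v
  ... | yes refl = ⊥-elim (¬g-v g-u)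
  ... | no u≢v with QP.≤-total (lookup w v) (lookup w u)
  ...   | inj₁ wv≤wu = dominates-switchable {f = h} u≢v (heavier-dominates {w = w} {f = h} rw-h u≢v wv≤wu) h-v
  ...   | inj₂ wu≤wv = ⊥-elim (¬g-v (dominates-switchable {f = g} (u≢v ∘ sym)
                                      (heavier-dominates {w = w} {f = g} rw-g (u≢v ∘ sym) wu≤wv) g-u))

heaviest : Vec ℚ (suc n) → Fin (suc n)
heaviest w = argmax (lookup w) zero (allFin _)

heaviest-dominates : ∀ {w} {f : BoolFun (suc n)} → RespectsWeights w f →
                     ∀ j → Dominates f (heaviest w) (punchIn (heaviest w) j)
heaviest-dominates {w = w} {f} rw j =
  heavier-dominates {w = w} {f = f} rw (punchInᵢ≢i _ j ∘ sym)
    (All.lookup (f[xs]≤f[argmax] {f = lookup w} zero (allFin _)) (∈-allFin (punchIn (heaviest w) j)))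

-- Counting extremal points and relevant variables

maximalFalse? : (f : BoolFun n) → Decidable (MaximalFalse f)
maximalFalse? f = maximal? (λ x → f x Bool.≟ false)

minimalTrue? : (f : BoolFun n) → Decidable (MinimalTrue f)
minimalTrue? f = minimal? (λ x → f x Bool.≟ true)

#maximalFalse #minimalTrue #extremal #relevant : BoolFun n → ℕ
#maximalFalse f = count (points _) (maximalFalse? f)
#minimalTrue  f = count (points _) (minimalTrue? f)
#extremal     f = #maximalFalse f + #minimalTrue f
#relevant     f = count (fins _) (switchable? f)

Tight : BoolFun n → Set
Tight f = #extremal f ≡ suc (#relevant f)

suc-shift : ∀ {e e′ k k′ : ℕ} → e ≡ suc e′ → k ≡ suc k′ → (e ≡ suc k) ⇔ (e′ ≡ suc k′)
suc-shift refl refl = mk⇔ suc-injective (cong suc)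

module Cofactors {n} (f : BoolFun (suc n)) (pos : Positive f) (i : Fin (suc n)) where

  f₀ f₁ : BoolFun n
  f₀ = cofactor f i false
  f₁ = cofactor f i true

  f₀-positive : Positive f₀
  f₀-positive = cofactor-positive pos i false

  f₁-positive : Positive f₁
  f₁-positive = cofactor-positive pos i true

  f₀⇒f₁ : ∀ {y} → f₀ y ≡ true → f₁ y ≡ true
  f₀⇒f₁ f₀y = pos _ _ f₀y (insertAt-mono i (λ _ → refl) ⪯-refl)

  ¬f₁⇒¬f₀ : ∀ {y} → f₁ y ≡ false → f₀ y ≡ false
  ¬f₁⇒¬f₀ {y} f₁y with f₀ y in f₀y
  ... | false = refl
  ... | true  = trans (sym (f₀⇒f₁ f₀y)) f₁y

  -- By minimal-insertAt-true these are the minimal true points of f with x_i = 1; dually,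
  -- NewMaximalFalse are the maximal false points of f with x_i = 0.
  NewMinimalTrue NewMaximalFalse : Pred (Point n) 0ℓ
  NewMinimalTrue  = MinimalTrue f₁ ∩ ∁ (λ y → f₀ y ≡ true)
  NewMaximalFalse = MaximalFalse f₀ ∩ ∁ (λ y → f₁ y ≡ false)

  #newMinimalTrue #newMaximalFalse : ℕ
  #newMinimalTrue  = count (points n) (minimalTrue? f₁ ∩? ∁? (λ y → f₀ y Bool.≟ true))
  #newMaximalFalse = count (points n) (maximalFalse? f₀ ∩? ∁? (λ y → f₁ y Bool.≟ false))

  #maximalFalse-split : #maximalFalse f ≡ #newMaximalFalse + #maximalFalse f₁
  #maximalFalse-split = trans (count-insertAt i (maximalFalse? f))
    (cong₂ _+_ (count-cong (points n) _ _ (λ _ → maximal-insertAt-false i (false-downward pos)))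
               (count-cong (points n) _ _ (λ _ → maximal-insertAt-true i)))

  #minimalTrue-split : #minimalTrue f ≡ #minimalTrue f₀ + #newMinimalTrue
  #minimalTrue-split = trans (count-insertAt i (minimalTrue? f))
    (cong₂ _+_ (count-cong (points n) _ _ (λ _ → minimal-insertAt-false i))
               (count-cong (points n) _ _ (λ _ → minimal-insertAt-true i (true-upward pos))))

  #maximalFalse₀-≤ : #maximalFalse f₀ ≤ #newMaximalFalse + #maximalFalse f₁
  #maximalFalse₀-≤ = begin
    #maximalFalse f₀
      ≡⟨ count-partition (points n) (maximalFalse? f₀) f₁≡false? ⟩
    count (points n) (maximalFalse? f₀ ∩? f₁≡false?) + #newMaximalFalse
      ≤⟨ +-monoˡ-≤ _ (count-mono (points n) _ (maximalFalse? f₁)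
                        (λ _ (max , f₁y) → maximal-restrict (λ _ → ¬f₁⇒¬f₀) max f₁y)) ⟩
    #maximalFalse f₁ + #newMaximalFalse
      ≡⟨ +-comm (#maximalFalse f₁) _ ⟩
    #newMaximalFalse + #maximalFalse f₁
      ∎
    where
    open ℕ-≤-Reasoning
    f₁≡false? = λ y → f₁ y Bool.≟ false

  #minimalTrue₁-≤ : #minimalTrue f₁ ≤ #minimalTrue f₀ + #newMinimalTrue
  #minimalTrue₁-≤ = begin
    #minimalTrue f₁
      ≡⟨ count-partition (points n) (minimalTrue? f₁) f₀≡true? ⟩
    count (points n) (minimalTrue? f₁ ∩? f₀≡true?) + #newMinimalTrue
      ≤⟨ +-monoˡ-≤ _ (count-mono (points n) _ (minimalTrue? f₀)
                        (λ _ (min , f₀y) → minimal-restrict (λ _ → f₀⇒f₁) min f₀y)) ⟩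
    #minimalTrue f₀ + #newMinimalTrue
      ∎
    where
    open ℕ-≤-Reasoning
    f₀≡true? = λ y → f₀ y Bool.≟ true

  #extremal₀-≤ : #extremal f₀ + #newMinimalTrue ≤ #extremal f
  #extremal₀-≤ = begin
    (#maximalFalse f₀ + #minimalTrue f₀) + #newMinimalTrue   ≡⟨ +-assoc (#maximalFalse f₀) _ _ ⟩
    #maximalFalse f₀ + (#minimalTrue f₀ + #newMinimalTrue)   ≤⟨ +-monoˡ-≤ _ #maximalFalse₀-≤ ⟩
    (#newMaximalFalse + #maximalFalse f₁) + (#minimalTrue f₀ + #newMinimalTrue)
                                                              ≡⟨ sym (cong₂ _+_ #maximalFalse-split #minimalTrue-split) ⟩
    #extremal f                                               ∎
    where open ℕ-≤-Reasoning

  #extremal₁-≤ : #extremal f₁ + #newMaximalFalse ≤ #extremal f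
  #extremal₁-≤ = begin
    (#maximalFalse f₁ + #minimalTrue f₁) + #newMaximalFalse  ≡⟨ +-comm (#maximalFalse f₁ + _) _ ⟩
    #newMaximalFalse + (#maximalFalse f₁ + #minimalTrue f₁)  ≡⟨ sym (+-assoc #newMaximalFalse _ _) ⟩
    (#newMaximalFalse + #maximalFalse f₁) + #minimalTrue f₁  ≤⟨ +-monoʳ-≤ _ #minimalTrue₁-≤ ⟩
    (#newMaximalFalse + #maximalFalse f₁) + (#minimalTrue f₀ + #newMinimalTrue)
                                                              ≡⟨ sym (cong₂ _+_ #maximalFalse-split #minimalTrue-split) ⟩
    #extremal f                                               ∎
    where open ℕ-≤-Reasoning

  private
    on-off-cong : ∀ {a b c d : Bool} → a ≡ c → b ≡ d → (a ≡ true × b ≡ false) ⇔ (c ≡ true × d ≡ false)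
    on-off-cong refl refl = ⇔.refl

  switch-pivot : ∀ b y → Switch f i (insertAt y i b) ⇔ (f₁ y ≡ true × f₀ y ≡ false)
  switch-pivot b y = on-off-cong (cong f (insertAt-[]≔-same y i)) (cong f (insertAt-[]≔-same y i))

  switch-punchIn : ∀ b y j → Switch f (punchIn i j) (insertAt y i b) ⇔ Switch (cofactor f i b) j y
  switch-punchIn b y j = on-off-cong (cong f (insertAt-[]≔-punchIn y i j)) (cong f (insertAt-[]≔-punchIn y i j))

  switchable-pivot : Switchable f i ⇔ (∃ λ y → f₁ y ≡ true × f₀ y ≡ false)
  switchable-pivot = mk⇔
    (λ (x , sw) → ∀-insertAt i {R = λ x → Switch f i x → ∃ λ y → f₁ y ≡ true × f₀ y ≡ false}
                    (λ b y sw → y , to (switch-pivot b y) sw) x sw)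
    (λ (y , gap) → insertAt y i false , from (switch-pivot false y) gap)

  switchable-punchIn : ∀ j → Switchable f (punchIn i j) ⇔ (Switchable f₀ j ⊎ Switchable f₁ j)
  switchable-punchIn j = mk⇔
    (λ (x , sw) → ∀-insertAt i {R = λ x → Switch f (punchIn i j) x → Switchable f₀ j ⊎ Switchable f₁ j}
                    (λ { false y sw → inj₁ (y , to (switch-punchIn false y j) sw)
                       ; true  y sw → inj₂ (y , to (switch-punchIn true y j) sw) }) x sw)
    (λ { (inj₁ (y , sw)) → insertAt y i false , from (switch-punchIn false y j) sw
       ; (inj₂ (y , sw)) → insertAt y i true  , from (switch-punchIn true y j) sw })

  module _ {g : BoolFun n} (punchIn-switchable : ∀ j → Switchable f (punchIn i j) ⇔ Switchable g j) where

    private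
      #relevant-punchIn : count (fins n) (switchable? f ∘ punchIn i) ≡ #relevant g
      #relevant-punchIn = count-cong (fins n) _ (switchable? g) punchIn-switchable

    #relevant-accept : Switchable f i → #relevant f ≡ suc (#relevant g)
    #relevant-accept sw = trans (count-punchIn-accept (switchable? f) i sw) (cong suc #relevant-punchIn)

    #relevant-reject : ¬ Switchable f i → #relevant f ≡ #relevant g
    #relevant-reject ¬sw = trans (count-punchIn-reject (switchable? f) i ¬sw) #relevant-punchIn

    #relevant-≤ : ∀ {x} → (Switchable f i → 1 ≤ x) → #relevant f ≤ x + #relevant g
    #relevant-≤ {x} 1≤x with switchable? f i
    ... | yes sw = ≤-trans (≤-reflexive (#relevant-accept sw)) (+-monoˡ-≤ (#relevant g) (1≤x sw))
    ... | no ¬sw = ≤-trans (≤-reflexive (#relevant-reject ¬sw)) (m≤n+m _ x)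

  punchIn-switchable₀ : (∀ j → Switchable f₁ j → Switchable f₀ j) →
                        ∀ j → Switchable f (punchIn i j) ⇔ Switchable f₀ j
  punchIn-switchable₀ f₁⊆f₀ j = ⇔.trans (switchable-punchIn j) (mk⇔ [ id , f₁⊆f₀ j ] inj₁)

  punchIn-switchable₁ : (∀ j → Switchable f₀ j → Switchable f₁ j) →
                        ∀ j → Switchable f (punchIn i j) ⇔ Switchable f₁ j
  punchIn-switchable₁ f₀⊆f₁ j = ⇔.trans (switchable-punchIn j) (mk⇔ [ f₀⊆f₁ j , id ] inj₂)

  #newMinimalTrue-≥1 : Switchable f i → 1 ≤ #newMinimalTrue
  #newMinimalTrue-≥1 sw with p , f₁p , f₀p ← to switchable-pivot sw
                        with a , a⪯p , min ← minimal-below (λ y → f₁ y Bool.≟ true) f₁p =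
    count-≥1 (points n) _ {a} (min , λ f₀a → true≢false (trans (sym (f₀-positive a p f₀a a⪯p)) f₀p))

  #newMaximalFalse-≥1 : Switchable f i → 1 ≤ #newMaximalFalse
  #newMaximalFalse-≥1 sw with p , f₁p , f₀p ← to switchable-pivot sw
                         with M , p⪯M , max ← maximal-above (λ y → f₀ y Bool.≟ false) f₀p =
    count-≥1 (points n) _ {M} (max , λ f₁M → true≢false (trans (sym f₁p) (false-downward f₁-positive p⪯M f₁M)))

  module _ (i-dominates : ∀ j → Dominates f i (punchIn i j)) where

    exchange : ∀ {y j} → lookup y j ≡ true → f₀ y ≡ true → f₁ (y [ j ]≔ false) ≡ true
    exchange {y} {j} y-j f₀y =
      subst (λ z → f z ≡ true) after (i-dominates j (insertAt y i false) (subst (λ z → f z ≡ true) (sym before) f₀y))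
      where
      before : insertAt y i false [ i ]≔ false [ punchIn i j ]≔ true ≡ insertAt y i false
      before = trans (cong (_[ punchIn i j ]≔ true) (insertAt-[]≔-same y i))
                     (trans (insertAt-[]≔-punchIn y i j) (cong (λ z → insertAt z i false) ([]≔-no-op y y-j)))
      after : insertAt y i false [ i ]≔ true [ punchIn i j ]≔ false ≡ insertAt (y [ j ]≔ false) i true
      after = trans (cong (_[ punchIn i j ]≔ false) (insertAt-[]≔-same y i)) (insertAt-[]≔-punchIn y i j)

    new-below : ∀ {m} → MinimalTrue f₀ m → ∀ {l} → lookup m l ≡ true →
                ∃ λ a → a ⪯ (m [ l ]≔ false) × NewMinimalTrue a
    new-below m-min m-l =
      let a , a⪯ , a-min = minimal-below (λ y → f₁ y Bool.≟ true) (exchange m-l (proj₁ m-min))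
      in a , a⪯ , a-min , λ f₀a → minimal-lower m-min m-l (true-upward f₀-positive a⪯ f₀a)

    new-above : ∀ {M} → MaximalFalse f₁ M → ∀ {l} → lookup M l ≡ false →
                ∃ λ b → (M [ l ]≔ true) ⪯ b × NewMaximalFalse b
    new-above {M} M-max {l} M-l =
      let b , ⪯b , b-max = maximal-above (λ y → f₀ y Bool.≟ false) f₀-raised
      in b , ⪯b , b-max , λ f₁b → maximal-raise M-max M-l (false-downward f₁-positive ⪯b f₁b)
      where
      f₀-raised : f₀ (M [ l ]≔ true) ≡ false
      f₀-raised with f₀ (M [ l ]≔ true) in f₀M↑
      ... | false = refl
      ... | true  = trans (sym (subst (λ z → f₁ z ≡ true) lowered (exchange (lookup∘update l M true) f₀M↑)))
                          (proj₁ M-max)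
        where
        lowered : M [ l ]≔ true [ l ]≔ false ≡ M
        lowered = trans ([]≔-idempotent M l) ([]≔-no-op M M-l)

    -- Lowering two different ones j, l of a minimal true point m of f₀ keeps f₁ true (exchange);
    -- the minimal true points of f₁ found below m[j:=0] and m[l:=0] are new and differ at l.
    #newMinimalTrue-≥2 : ∀ {p q} → f₀ p ≡ true → f₁ q ≡ false → 2 ≤ #newMinimalTrue
    #newMinimalTrue-≥2 {p} {q} f₀p f₁q =
      let f₁0                = false-downward f₁-positive (zeros-⪯ q) f₁q
          m , _ , m-min      = minimal-below (λ y → f₀ y Bool.≟ true) f₀p
          j , m-j            = true-point-has-one {g = f₀} (¬f₁⇒¬f₀ f₁0) (proj₁ m-min)
          a , a⪯ , a-new     = new-below m-min m-j
          l , a-l            = true-point-has-one {g = f₁} f₁0 (proj₁ (proj₁ a-new))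
          a′ , a′⪯ , a′-new  = new-below m-min (PW.lookup (⪯-trans a⪯ ([]≔false-⪯ m j)) l a-l)
      in count-≥2 (points n) _ a-new a′-new
           (λ a≡a′ → true≢false (trans (sym a-l)
             (⪯-lookup-false (subst (_⪯ (m [ l ]≔ false)) (sym a≡a′) a′⪯) l (lookup∘update l m false))))

    #newMaximalFalse-≥2 : ∀ {p q} → f₀ p ≡ true → f₁ q ≡ false → 2 ≤ #newMaximalFalse
    #newMaximalFalse-≥2 {p} {q} f₀p f₁q =
      let f₀1                = true-upward f₀-positive (⪯-ones p) f₀p
          M , _ , M-max      = maximal-above (λ y → f₁ y Bool.≟ false) f₁q
          j , M-j            = false-point-has-zero {g = f₁} (f₀⇒f₁ f₀1) (proj₁ M-max)
          b , ⪯b , b-new     = new-above M-max M-j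
          l , b-l            = false-point-has-zero {g = f₀} f₀1 (proj₁ (proj₁ b-new))
          b′ , ⪯b′ , b′-new  = new-above M-max (⪯-lookup-false (⪯-trans (⪯-[]≔true M j) ⪯b) l b-l)
      in count-≥2 (points n) _ b-new b′-new
           (λ b≡b′ → true≢false (trans (sym (PW.lookup (subst ((M [ l ]≔ true) ⪯_) (sym b≡b′) ⪯b′) l
                                                        (lookup∘update l M true)))
                                        b-l))

  module _ (f₀-false : ∀ y → f₀ y ≡ false) {z} (f₁z : f₁ z ≡ true) where

    #extremal-and : #extremal f ≡ suc (#extremal f₁)
    #extremal-and = begin
      #extremal f
        ≡⟨ cong₂ _+_ #maximalFalse-split #minimalTrue-split ⟩
      (#newMaximalFalse + #maximalFalse f₁) + (#minimalTrue f₀ + #newMinimalTrue)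
        ≡⟨ cong₂ _+_ (cong (_+ #maximalFalse f₁) new-max≡1) (cong₂ _+_ min₀≡0 new-min≡min₁) ⟩
      suc (#extremal f₁)
        ∎
      where
      open ≡-Reasoning
      new-max≡1 : #newMaximalFalse ≡ 1
      new-max≡1 = count-≡1 (points n) _ λ x → mk⇔
        (λ (max , _) → to (maximal-universal f₀-false x) max)
        (λ { refl → from (maximal-universal f₀-false ones) refl ,
                    λ f₁1 → true≢false (trans (sym (true-upward f₁-positive (⪯-ones z) f₁z)) f₁1) })
      min₀≡0 : #minimalTrue f₀ ≡ 0
      min₀≡0 = count-≡0 (points n) _ λ x (f₀x , _) → true≢false (trans (sym f₀x) (f₀-false x))
      new-min≡min₁ : #newMinimalTrue ≡ #minimalTrue f₁
      new-min≡min₁ = count-cong (points n) _ _ λ x →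
        mk⇔ proj₁ (λ min → min , λ f₀x → true≢false (trans (sym f₀x) (f₀-false x)))

    #relevant-and : #relevant f ≡ suc (#relevant f₁)
    #relevant-and = #relevant-accept {g = f₁}
      (punchIn-switchable₁ (λ _ sw → ⊥-elim (constant-unswitchable {g = f₀} f₀-false sw)))
      (from switchable-pivot (z , f₁z , f₀-false z))

    tight-and : Tight f ⇔ Tight f₁
    tight-and = suc-shift #extremal-and #relevant-and

  module _ (f₁-true : ∀ y → f₁ y ≡ true) {z} (f₀z : f₀ z ≡ false) where

    #extremal-or : #extremal f ≡ suc (#extremal f₀)
    #extremal-or = begin
      #extremal f
        ≡⟨ cong₂ _+_ #maximalFalse-split #minimalTrue-split ⟩
      (#newMaximalFalse + #maximalFalse f₁) + (#minimalTrue f₀ + #newMinimalTrue)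
        ≡⟨ cong₂ _+_ (cong₂ _+_ new-max≡max₀ max₁≡0) (cong (#minimalTrue f₀ +_) new-min≡1) ⟩
      (#maximalFalse f₀ + 0) + (#minimalTrue f₀ + 1)
        ≡⟨ cong₂ _+_ (+-identityʳ (#maximalFalse f₀)) (+-comm (#minimalTrue f₀) 1) ⟩
      #maximalFalse f₀ + suc (#minimalTrue f₀)
        ≡⟨ +-suc (#maximalFalse f₀) (#minimalTrue f₀) ⟩
      suc (#extremal f₀)
        ∎
      where
      open ≡-Reasoning
      new-max≡max₀ : #newMaximalFalse ≡ #maximalFalse f₀
      new-max≡max₀ = count-cong (points n) _ _ λ x →
        mk⇔ proj₁ (λ max → max , λ f₁x → true≢false (trans (sym (f₁-true x)) f₁x))
      max₁≡0 : #maximalFalse f₁ ≡ 0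
      max₁≡0 = count-≡0 (points n) _ λ x (f₁x , _) → true≢false (trans (sym (f₁-true x)) f₁x)
      new-min≡1 : #newMinimalTrue ≡ 1
      new-min≡1 = count-≡1 (points n) _ λ x → mk⇔
        (λ (min , _) → to (minimal-universal f₁-true x) min)
        (λ { refl → from (minimal-universal f₁-true zeros) refl ,
                    λ f₀0 → true≢false (trans (sym f₀0) (false-downward f₀-positive (zeros-⪯ z) f₀z)) })

    #relevant-or : #relevant f ≡ suc (#relevant f₀)
    #relevant-or = #relevant-accept {g = f₀}
      (punchIn-switchable₀ (λ _ sw → ⊥-elim (constant-unswitchable {g = f₁} f₁-true sw)))
      (from switchable-pivot (z , f₁-true z , f₀z))

    tight-or : Tight f ⇔ Tight f₀
    tight-or = suc-shift #extremal-or #relevant-or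

  module _ (f₀≗f₁ : ∀ y → f₀ y ≡ f₁ y) where

    #extremal-irrelevant : #extremal f ≡ #extremal f₀
    #extremal-irrelevant = begin
      #extremal f
        ≡⟨ cong₂ _+_ #maximalFalse-split #minimalTrue-split ⟩
      (#newMaximalFalse + #maximalFalse f₁) + (#minimalTrue f₀ + #newMinimalTrue)
        ≡⟨ cong₂ _+_ (cong₂ _+_ new-max≡0 max₁≡max₀) (cong (#minimalTrue f₀ +_) new-min≡0) ⟩
      #maximalFalse f₀ + (#minimalTrue f₀ + 0)
        ≡⟨ cong (#maximalFalse f₀ +_) (+-identityʳ (#minimalTrue f₀)) ⟩
      #extremal f₀
        ∎
      where
      open ≡-Reasoning
      new-max≡0 : #newMaximalFalse ≡ 0
      new-max≡0 = count-≡0 (points n) _ λ x ((f₀x , _) , ¬f₁x) → ¬f₁x (trans (sym (f₀≗f₁ x)) f₀x)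
      max₁≡max₀ : #maximalFalse f₁ ≡ #maximalFalse f₀
      max₁≡max₀ = count-cong (points n) _ _
        (maximal-cong (λ y → mk⇔ (trans (f₀≗f₁ y)) (trans (sym (f₀≗f₁ y)))))
      new-min≡0 : #newMinimalTrue ≡ 0
      new-min≡0 = count-≡0 (points n) _ λ x ((f₁x , _) , ¬f₀x) → ¬f₀x (trans (f₀≗f₁ x) f₁x)

    #relevant-irrelevant : #relevant f ≡ #relevant f₀
    #relevant-irrelevant =
      #relevant-reject {g = f₀} (punchIn-switchable₀ (λ _ → switchable-cong {g = f₁} {h = f₀} (sym ∘ f₀≗f₁)))
        (λ sw → let y , f₁y , f₀y = to switchable-pivot sw
                in true≢false (trans (sym f₁y) (trans (sym (f₀≗f₁ y)) f₀y)))

    tight-irrelevant : Tight f ⇔ Tight f₀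
    tight-irrelevant = subst₂ (λ e k → Tight f ⇔ (e ≡ suc k)) #extremal-irrelevant #relevant-irrelevant ⇔.refl

tight-const : ∀ {f : BoolFun n} {b} → (∀ x → f x ≡ b) → Tight f
tight-const {n} {f} {b} f≡b = trans (#extremal≡1 b f≡b) (cong suc (sym #relevant≡0))
  where
  #relevant≡0 : #relevant f ≡ 0
  #relevant≡0 = count-≡0 (fins n) _ (λ _ → constant-unswitchable f≡b)
  #extremal≡1 : ∀ b → (∀ x → f x ≡ b) → #extremal f ≡ 1
  #extremal≡1 false f≡false = cong₂ _+_
    (count-≡1 (points n) _ (maximal-universal f≡false))
    (count-≡0 (points n) _ λ x (fx , _) → true≢false (trans (sym fx) (f≡false x)))
  #extremal≡1 true f≡true = cong₂ _+_
    (count-≡0 (points n) _ λ x (fx , _) → true≢false (trans (sym (f≡true x)) fx))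
    (count-≡1 (points n) _ (minimal-universal f≡true))

tight-cong : ∀ {f g : BoolFun n} → (∀ x → f x ≡ g x) → Tight f → Tight g
tight-cong {n} {f} {g} f≗g tight = trans (sym #extremal≡) (trans tight (cong suc #relevant≡))
  where
  #extremal≡ : #extremal f ≡ #extremal g
  #extremal≡ = cong₂ _+_
    (count-cong (points n) _ _ (maximal-cong (λ y → mk⇔ (trans (sym (f≗g y))) (trans (f≗g y)))))
    (count-cong (points n) _ _ (minimal-cong (λ y → mk⇔ (trans (sym (f≗g y))) (trans (f≗g y)))))
  #relevant≡ : #relevant f ≡ #relevant g
  #relevant≡ = count-cong (fins n) _ _ (λ _ → mk⇔ (switchable-cong f≗g) (switchable-cong (sym ∘ f≗g)))

-- Nested formulas

weaken : Fin (suc n) → Nested n → Nested (suc n)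
weaken i (lit j p)      = lit (punchIn i j) p
weaken i (node j p o t) = node (punchIn i j) p o (weaken i t)

evalLit-weaken : ∀ i (j : Fin n) p (x : Point (suc n)) → evalLit (punchIn i j) p x ≡ evalLit j p (removeAt x i)
evalLit-weaken i j true  x = lookup-punchIn-removeAt x i j
evalLit-weaken i j false x = cong not (lookup-punchIn-removeAt x i j)

eval-weaken : ∀ i (ψ : Nested n) x → eval (weaken i ψ) x ≡ eval ψ (removeAt x i)
eval-weaken i (lit j p)          x = evalLit-weaken i j p x
eval-weaken i (node j p true t)  x = cong₂ _∨_ (evalLit-weaken i j p x) (eval-weaken i t x)
eval-weaken i (node j p false t) x = cong₂ _∧_ (evalLit-weaken i j p x) (eval-weaken i t x)

∈-vars-weaken : ∀ i (ψ : Nested n) {k} → k ∈ vars (weaken i ψ) → ∃ λ j → j ∈ vars ψ × k ≡ punchIn i j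
∈-vars-weaken i (lit j p)      (here k≡) = j , here refl , k≡
∈-vars-weaken i (node j p o t) (here k≡) = j , here refl , k≡
∈-vars-weaken i (node j p o t) (there k∈) = let j′ , j′∈ , k≡ = ∈-vars-weaken i t k∈ in j′ , there j′∈ , k≡

weaken-fresh : ∀ i (ψ : Nested n) → i ∉ vars (weaken i ψ)
weaken-fresh i ψ i∈ = let j , _ , i≡ = ∈-vars-weaken i ψ i∈ in punchInᵢ≢i i j (sym i≡)

weaken-wellFormed : ∀ i (ψ : Nested n) → WellFormed ψ → WellFormed (weaken i ψ)
weaken-wellFormed i (lit j p)      _           = tt
weaken-wellFormed i (node j p o t) (j∉t , wf) =
  (λ pj∈ → let j′ , j′∈ , pj≡ = ∈-vars-weaken i t pj∈
           in j∉t (subst (_∈ vars t) (sym (punchIn-injective i j j′ pj≡)) j′∈)) ,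
  weaken-wellFormed i t wf

module _ {n} (f : BoolFun (suc n)) (i : Fin (suc n)) where

  private
    f₀ f₁ : BoolFun n
    f₀ = cofactor f i false
    f₁ = cofactor f i true

    shannon : ∀ {g : BoolFun n} {_∙_ : Bool → Bool → Bool} →
              (∀ b y → f (insertAt y i b) ≡ b ∙ g y) → ∀ x → f x ≡ lookup x i ∙ g (removeAt x i)
    shannon {g} {_∙_} f≡ = ∀-insertAt i λ b y →
      trans (f≡ b y) (sym (cong₂ _∙_ (insertAt-lookup y i b) (cong g (removeAt-insertAt y i b))))

  linearReadOnce-or : (∀ y → f₁ y ≡ true) → LinearReadOnce f₀ → LinearReadOnce f
  linearReadOnce-or f₁-true = extend
    where
    f≡ : ∀ x → f x ≡ lookup x i ∨ f₀ (removeAt x i)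
    f≡ = shannon {g = f₀} {_∙_ = _∨_} λ { false y → refl ; true y → f₁-true y }
    extend : LinearReadOnce f₀ → LinearReadOnce f
    extend (inj₁ (true , f₀≡)) =
      inj₁ (true , λ x → trans (f≡ x) (trans (cong (lookup x i ∨_) (f₀≡ _)) (∨-zeroʳ _)))
    extend (inj₁ (false , f₀≡)) =
      inj₂ (lit i true , tt , λ x → trans (f≡ x) (trans (cong (lookup x i ∨_) (f₀≡ _)) (∨-identityʳ _)))
    extend (inj₂ (ψ , wf , f₀≡)) = inj₂ (node i true true (weaken i ψ) , (weaken-fresh i ψ , weaken-wellFormed i ψ wf) ,
      λ x → trans (f≡ x) (cong (lookup x i ∨_) (trans (f₀≡ _) (sym (eval-weaken i ψ x)))))

  linearReadOnce-and : (∀ y → f₀ y ≡ false) → LinearReadOnce f₁ → LinearReadOnce f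
  linearReadOnce-and f₀-false = extend
    where
    f≡ : ∀ x → f x ≡ lookup x i ∧ f₁ (removeAt x i)
    f≡ = shannon {g = f₁} {_∙_ = _∧_} λ { false y → f₀-false y ; true y → refl }
    extend : LinearReadOnce f₁ → LinearReadOnce f
    extend (inj₁ (false , f₁≡)) =
      inj₁ (false , λ x → trans (f≡ x) (trans (cong (lookup x i ∧_) (f₁≡ _)) (∧-zeroʳ _)))
    extend (inj₁ (true , f₁≡)) =
      inj₂ (lit i true , tt , λ x → trans (f≡ x) (trans (cong (lookup x i ∧_) (f₁≡ _)) (∧-identityʳ _)))
    extend (inj₂ (ψ , wf , f₁≡)) = inj₂ (node i true false (weaken i ψ) , (weaken-fresh i ψ , weaken-wellFormed i ψ wf) ,
      λ x → trans (f≡ x) (cong (lookup x i ∧_) (trans (f₁≡ _) (sym (eval-weaken i ψ x)))))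

evalLit-[]≔ : ∀ {i j : Fin n} p → i ≢ j → ∀ x b → evalLit j p (x [ i ]≔ b) ≡ evalLit j p x
evalLit-[]≔ true  i≢j x b = lookup∘update′ (i≢j ∘ sym) x b
evalLit-[]≔ false i≢j x b = cong not (lookup∘update′ (i≢j ∘ sym) x b)

eval-[]≔ : ∀ (φ : Nested n) {i} → i ∉ vars φ → ∀ x b → eval φ (x [ i ]≔ b) ≡ eval φ x
eval-[]≔ (lit j p)          i∉ x b = evalLit-[]≔ p (i∉ ∘ here) x b
eval-[]≔ (node j p true t)  i∉ x b = cong₂ _∨_ (evalLit-[]≔ p (i∉ ∘ here) x b) (eval-[]≔ t (i∉ ∘ there) x b)
eval-[]≔ (node j p false t) i∉ x b = cong₂ _∧_ (evalLit-[]≔ p (i∉ ∘ here) x b) (eval-[]≔ t (i∉ ∘ there) x b)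

evalLit-set : ∀ (i : Fin n) p x → evalLit i p (x [ i ]≔ p) ≡ true
evalLit-set i true  x = lookup∘update i x true
evalLit-set i false x = cong not (lookup∘update i x false)

evalLit-unset : ∀ (i : Fin n) p x → evalLit i p (x [ i ]≔ not p) ≡ false
evalLit-unset i true  x = lookup∘update i x false
evalLit-unset i false x = cong not (lookup∘update i x true)

nonconstant : ∀ (φ : Nested n) → WellFormed φ → (∃ λ x → eval φ x ≡ true) × (∃ λ x → eval φ x ≡ false)
nonconstant (lit i p) _ = (zeros [ i ]≔ p , evalLit-set i p zeros) , (zeros [ i ]≔ not p , evalLit-unset i p zeros)
nonconstant (node i p true t) (i∉t , wf) =
  let (x₁ , _) , (x₀ , t-x₀) = nonconstant t wf in
  (x₁ [ i ]≔ p , cong (_∨ eval t (x₁ [ i ]≔ p)) (evalLit-set i p x₁)) ,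
  (x₀ [ i ]≔ not p , cong₂ _∨_ (evalLit-unset i p x₀) (trans (eval-[]≔ t i∉t x₀ (not p)) t-x₀))
nonconstant (node i p false t) (i∉t , wf) =
  let (x₁ , t-x₁) , (x₀ , _) = nonconstant t wf in
  (x₁ [ i ]≔ p , cong₂ _∧_ (evalLit-set i p x₁) (trans (eval-[]≔ t i∉t x₁ p) t-x₁)) ,
  (x₀ [ i ]≔ not p , cong (_∧ eval t (x₀ [ i ]≔ not p)) (evalLit-unset i p x₀))

negative-head-antiswitch : ∀ (i : Fin n) o t → WellFormed (node i false o t) →
  ∃ λ z → eval (node i false o t) (z [ i ]≔ false) ≡ true × eval (node i false o t) (z [ i ]≔ true) ≡ false
negative-head-antiswitch i true t (i∉t , wf) =
  let x₀ , t-x₀ = proj₂ (nonconstant t wf) in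
  x₀ , cong (_∨ eval t (x₀ [ i ]≔ false)) (evalLit-set i false x₀) ,
       cong₂ _∨_ (evalLit-unset i false x₀) (trans (eval-[]≔ t i∉t x₀ true) t-x₀)
negative-head-antiswitch i false t (i∉t , wf) =
  let x₁ , t-x₁ = proj₁ (nonconstant t wf) in
  x₁ , cong₂ _∧_ (evalLit-set i false x₁) (trans (eval-[]≔ t i∉t x₁ false) t-x₁) ,
       cong (_∧ eval t (x₁ [ i ]≔ true)) (evalLit-unset i false x₁)

module Independent {n} (g : BoolFun (suc n)) (i : Fin (suc n)) (g-indep : ∀ x b → g (x [ i ]≔ b) ≡ g x) where

  cofactor-removeAt : ∀ x b → cofactor g i b (removeAt x i) ≡ g x
  cofactor-removeAt x b = trans (cong g (insertAt-removeAt-[]≔ x i b)) (g-indep x b)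

  cofactors-equal : ∀ y → cofactor g i false y ≡ cofactor g i true y
  cofactors-equal y = trans (sym (g-indep (insertAt y i false) true)) (cong g (insertAt-[]≔-same y i))

  cofactor-tight : Positive g → Tight g → ∀ b → Tight (cofactor g i b)
  cofactor-tight pos tight false = to (Cofactors.tight-irrelevant g pos i cofactors-equal) tight
  cofactor-tight pos tight true  = tight-cong cofactors-equal (cofactor-tight pos tight false)

formula-tight : ∀ (φ : Nested n) → WellFormed φ → Positive (eval φ) → Tight (eval φ)
formula-tight {suc n} (lit i true) _ pos = from (tight-or f₁-true (f₀-false zeros)) (tight-const {f = f₀} f₀-false)
  where
  open Cofactors (eval (lit i true)) pos i
  f₀-false : ∀ y → f₀ y ≡ false
  f₀-false y = insertAt-lookup y i false
  f₁-true : ∀ y → f₁ y ≡ true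
  f₁-true y = insertAt-lookup y i true
formula-tight {suc n} (lit i false) _ pos =
  ⊥-elim (positive-no-antiswitch pos {i} {zeros} (evalLit-set i false zeros , evalLit-unset i false zeros))
formula-tight {suc n} (node i false o t) wf pos =
  ⊥-elim (positive-no-antiswitch pos (proj₂ (negative-head-antiswitch i o t wf)))
formula-tight {suc n} (node i true true t) (i∉t , wf) pos =
  from (tight-or f₁-true f₀-false-somewhere) (tight-cong (sym ∘ f₀≗t₀) (cofactor-tight t-positive t-tight false))
  where
  open Cofactors (eval (node i true true t)) pos i
  open Independent (eval t) i (eval-[]≔ t i∉t)
  t-positive : Positive (eval t)
  t-positive = positive-cong
    (λ x → trans (cong (_∨ eval t (x [ i ]≔ false)) (lookup∘update i x false)) (eval-[]≔ t i∉t x false))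
    (positive-∘-[]≔ pos i false)
  t-tight : Tight (eval t)
  t-tight = formula-tight t wf t-positive
  f₁-true : ∀ y → f₁ y ≡ true
  f₁-true y = cong (_∨ eval t (insertAt y i true)) (insertAt-lookup y i true)
  f₀≗t₀ : ∀ y → f₀ y ≡ cofactor (eval t) i false y
  f₀≗t₀ y = cong (_∨ eval t (insertAt y i false)) (insertAt-lookup y i false)
  f₀-false-somewhere : f₀ (removeAt (proj₁ (proj₂ (nonconstant t wf))) i) ≡ false
  f₀-false-somewhere = let x₀ , t-x₀ = proj₂ (nonconstant t wf) in
    trans (f₀≗t₀ (removeAt x₀ i)) (trans (cofactor-removeAt x₀ false) t-x₀)
formula-tight {suc n} (node i true false t) (i∉t , wf) pos =
  from (tight-and f₀-false f₁-true-somewhere) (tight-cong (sym ∘ f₁≗t₁) (cofactor-tight t-positive t-tight true))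
  where
  open Cofactors (eval (node i true false t)) pos i
  open Independent (eval t) i (eval-[]≔ t i∉t)
  t-positive : Positive (eval t)
  t-positive = positive-cong
    (λ x → trans (cong (_∧ eval t (x [ i ]≔ true)) (lookup∘update i x true)) (eval-[]≔ t i∉t x true))
    (positive-∘-[]≔ pos i true)
  t-tight : Tight (eval t)
  t-tight = formula-tight t wf t-positive
  f₀-false : ∀ y → f₀ y ≡ false
  f₀-false y = cong (_∧ eval t (insertAt y i false)) (insertAt-lookup y i false)
  f₁≗t₁ : ∀ y → f₁ y ≡ cofactor (eval t) i true y
  f₁≗t₁ y = cong (_∧ eval t (insertAt y i true)) (insertAt-lookup y i true)
  f₁-true-somewhere : f₁ (removeAt (proj₁ (proj₁ (nonconstant t wf))) i) ≡ true
  f₁-true-somewhere = let x₁ , t-x₁ = proj₁ (nonconstant t wf) in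
    trans (f₁≗t₁ (removeAt x₁ i)) (trans (cofactor-removeAt x₁ true) t-x₁)

linearReadOnce⇒tight : ∀ {f : BoolFun n} → Positive f → LinearReadOnce f → Tight f
linearReadOnce⇒tight _   (inj₁ (b , f≡b))       = tight-const f≡b
linearReadOnce⇒tight pos (inj₂ (φ , wf , f≗φ)) = tight-cong (sym ∘ f≗φ) (formula-tight φ wf (positive-cong f≗φ pos))

-- The bound and its equality case

lower-step : ∀ {k k′ e′ x e : ℕ} → k ≤ x + k′ → k′ < e′ → e′ + x ≤ e → k < e
lower-step {k} {k′} {e′} {x} {e} k≤ k′<e′ e′+x≤e = begin
  suc k        ≤⟨ s≤s k≤ ⟩
  suc (x + k′) ≡⟨ sym (+-suc x k′) ⟩
  x + suc k′   ≤⟨ +-monoʳ-≤ x k′<e′ ⟩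
  x + e′       ≡⟨ +-comm x e′ ⟩
  e′ + x       ≤⟨ e′+x≤e ⟩
  e            ∎
  where open ℕ-≤-Reasoning

-- Any variable can be split off here; only the strict bound needs a heaviest one.
#relevant<#extremal : ∀ (f : BoolFun n) {w} → Positive f → RespectsWeights w f → #relevant f < #extremal f
#relevant<#extremal {zero} f pos rw = ≤-reflexive (sym (tight-const {f = f} {b = f []} λ { [] → refl }))
#relevant<#extremal {suc n} f pos rw = by-nesting (switchable-nested {g = f₀} {h = f₁} rw₀ rw₁)
  where
  open Cofactors f pos zero
  rw₀ = cofactor-respectsWeights rw zero false
  rw₁ = cofactor-respectsWeights rw zero true
  by-nesting : (∀ j → Switchable f₁ j → Switchable f₀ j) ⊎ (∀ j → Switchable f₀ j → Switchable f₁ j) →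
               #relevant f < #extremal f
  by-nesting (inj₁ f₁⊆f₀) = lower-step (#relevant-≤ {g = f₀} (punchIn-switchable₀ f₁⊆f₀) #newMinimalTrue-≥1)
                                       (#relevant<#extremal f₀ f₀-positive rw₀) #extremal₀-≤
  by-nesting (inj₂ f₀⊆f₁) = lower-step (#relevant-≤ {g = f₁} (punchIn-switchable₁ f₀⊆f₁) #newMaximalFalse-≥1)
                                       (#relevant<#extremal f₁ f₁-positive rw₁) #extremal₁-≤

module _ {n} (f : BoolFun (suc n)) {w} (pos : Positive f) (rw : RespectsWeights w f) where

  open Cofactors f pos (heaviest w)

  private
    rw₀ = cofactor-respectsWeights rw (heaviest w) false
    rw₁ = cofactor-respectsWeights rw (heaviest w) true

  1+#relevant<#extremal : ∀ {p q} → f₀ p ≡ true → f₁ q ≡ false → suc (#relevant f) < #extremal f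
  1+#relevant<#extremal f₀p f₁q = by-nesting (switchable-nested {g = f₀} {h = f₁} rw₀ rw₁)
    where
    by-nesting : (∀ j → Switchable f₁ j → Switchable f₀ j) ⊎ (∀ j → Switchable f₀ j → Switchable f₁ j) →
                 suc (#relevant f) < #extremal f
    by-nesting (inj₁ f₁⊆f₀) = lower-step
      (≤-trans (s≤s (#relevant-≤ {g = f₀} (punchIn-switchable₀ f₁⊆f₀) (λ _ → ≤-refl)))
               (+-monoˡ-≤ (#relevant f₀) (#newMinimalTrue-≥2 (heaviest-dominates rw) f₀p f₁q)))
      (#relevant<#extremal f₀ f₀-positive rw₀) #extremal₀-≤
    by-nesting (inj₂ f₀⊆f₁) = lower-step
      (≤-trans (s≤s (#relevant-≤ {g = f₁} (punchIn-switchable₁ f₀⊆f₁) (λ _ → ≤-refl)))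
               (+-monoˡ-≤ (#relevant f₁) (#newMaximalFalse-≥2 (heaviest-dominates rw) f₀p f₁q)))
      (#relevant<#extremal f₁ f₁-positive rw₁) #extremal₁-≤

tight⇒linearReadOnce : ∀ (f : BoolFun n) {w} → Positive f → RespectsWeights w f → Tight f → LinearReadOnce f
tight⇒linearReadOnce {zero} f _ _ _ = inj₁ (f [] , λ { [] → refl })
tight⇒linearReadOnce {suc n} f {w} pos rw tight =
  by-cases (∃? (points n) (λ y → f₀ y Bool.≟ true)) (∃? (points n) (λ y → f₁ y Bool.≟ false))
  where
  i = heaviest w
  open Cofactors f pos i
  by-cases : Dec (∃ λ y → f₀ y ≡ true) → Dec (∃ λ y → f₁ y ≡ false) → LinearReadOnce f
  by-cases (yes (p , f₀p)) (yes (q , f₁q)) =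
    ⊥-elim (<-irrefl refl (≤-trans (1+#relevant<#extremal f pos rw f₀p f₁q) (≤-reflexive tight)))
  by-cases (no ¬f₀-true) _ =
    linearReadOnce-and f i f₀-false (f₁-linearReadOnce (∃? (points n) (λ y → f₁ y Bool.≟ true)))
    where
    f₀-false : ∀ y → f₀ y ≡ false
    f₀-false y = ¬-not (λ f₀y → ¬f₀-true (y , f₀y))
    f₁-linearReadOnce : Dec (∃ λ y → f₁ y ≡ true) → LinearReadOnce f₁
    f₁-linearReadOnce (yes (z , f₁z)) =
      tight⇒linearReadOnce f₁ f₁-positive (cofactor-respectsWeights rw i true) (to (tight-and f₀-false f₁z) tight)
    f₁-linearReadOnce (no ¬f₁-true) = inj₁ (false , λ y → ¬-not (λ f₁y → ¬f₁-true (y , f₁y)))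
  by-cases (yes _) (no ¬f₁-false) =
    linearReadOnce-or f i f₁-true (f₀-linearReadOnce (∃? (points n) (λ y → f₀ y Bool.≟ false)))
    where
    f₁-true : ∀ y → f₁ y ≡ true
    f₁-true y = ¬-not (λ f₁y → ¬f₁-false (y , f₁y))
    f₀-linearReadOnce : Dec (∃ λ y → f₀ y ≡ false) → LinearReadOnce f₀
    f₀-linearReadOnce (yes (z , f₀z)) =
      tight⇒linearReadOnce f₀ f₀-positive (cofactor-respectsWeights rw i false) (to (tight-or f₁-true f₀z) tight)
    f₀-linearReadOnce (no ¬f₀-false) = inj₁ (true , λ y → ¬-not (λ f₀y → ¬f₀-false (y , f₀y)))

theorem6 : (n : ℕ) (f : BoolFun n) → Positive f → Threshold f →
    (k m : ℕ) → HasCount (Relevant f) k → HasCount (Extremal f) m →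
    suc k ≤ m × ((m ≡ suc k) ⇔ LinearReadOnce f)
theorem6 n f pos threshold k m relevant-k extremal-m =
  subst₂ (λ k m → suc k ≤ m × ((m ≡ suc k) ⇔ LinearReadOnce f)) (sym k≡) (sym m≡)
    (#relevant<#extremal f pos rw , mk⇔ (tight⇒linearReadOnce f pos rw) (linearReadOnce⇒tight pos))
  where
  w : Vec ℚ n
  w = proj₁ (threshold⇒respectsWeights threshold)
  rw : RespectsWeights w f
  rw = proj₂ (threshold⇒respectsWeights threshold)
  k≡ : k ≡ #relevant f
  k≡ = hasCount⇒≡count (fins n) (switchable? f) (hasCount-cong (relevant⇔switchable pos) relevant-k)
  m≡ : m ≡ #extremal f
  m≡ = trans (hasCount⇒≡count (points n) (maximalFalse? f ∪? minimalTrue? f) extremal-m)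
             (count-∪ (points n) (maximalFalse? f) (minimalTrue? f)
                      (λ _ (fx≡false , _) (fx≡true , _) → true≢false (trans (sym fx≡true) fx≡false)))
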